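{- Let $k\in[n-1]$ and let $D$ be a $k$-row BPD with associated permutation $u$, whose first $k-1$ rows form a $(k-1)$-row BPD with associated permutation $w$. Let $c_1<\dots<c_m$ be the column indices of the horizontal-segment tiles and r-elbow tiles in row $k$ of $D$, and let $r_i$ be such that the pipe in tile $(k,c_i)$ is the pipe from row $r_i$. Define $w_m=w$ and $w_i=w_{i+1}t_{r_i,w^{ -1}(c_i)}$ for $i=m-1,\dots,1$. Then $w_1=u$ and $(w_1,w_2,\dots,w_m)$ is an increasing $k$-chain from $u$ to $w$.
   Context: $t_{a,b}$ denotes the transposition exchanging positions $a$ and $b$ (acting on the right, so $vt_{a,b}$ swaps the entries of $v$ in positions $a,b$); $\ell$ is the inversion number; $v\lessdot_k v'$ if $v'=vt_{a,b}$ with $a\le k<b$ and $\ell(v')=\ell(v)+1$. An increasing $k$-chain is $(v_1,\dots,v_d)$ with $v_1\lessdot_k\cdots\lessdot_k v_d$ such that the smaller of the two values swapped at each step strictly increases along the chain. Tiles (rows numbered from the top, columns $1..n$ from the left): blank; horizontal segment (joining left and right edges); vertical segment (joining top and bottom edges); crossing (horizontal and vertical segment); r-elbow (curve joining right edge to bottom edge); j-elbow (curve joining top edge to left edge). For $0\le k\le n$, a $k$-row BPD is a filling of a $k\times n$ grid by these tiles, consistent across shared edges, with no pipe on the top edge of row 1 or left edge of column 1, with a pipe meeting the right edge of column $n$ in each row (the "pipe from row $i$"), and in which two pipes cross at most once. Its associated permutation $v$ is the unique $v\in S_n$ with $v(k+1)>\dots>v(n)$ and, for $i\in[k]$, $v(i)$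 the column where the pipe from row $i$ exits the bottom edge of row $k$. -}

module Defs where

open import Data.Nat using (ℕ; zero; suc; _<_; _≤_; _<ᵇ_; _⊔_; _⊓_)
open import Data.Nat.Properties using (<⇒≤)
open import Data.Bool using (Bool; true; false; _∧_; if_then_else_)
open import Data.Fin using (Fin; zero; suc; toℕ; inject₁; inject≤)
open import Data.Fin.Permutation using (Permutation′; _⟨$⟩ʳ_; _⟨$⟩ˡ_; transpose)
open import Data.List using (List; map; allFin)
open import Data.Nat.ListAction using (sum)
open import Data.Product using (Σ; _×_; _,_; ∃)
open import Data.Sum using (_⊎_)
open import Relation.Binary.PropositionalEquality using (_≡_; _≢_)

data Tile : Set where
  blank horiz vert cross relbow jelbow : Tile

-- does the tile have a pipe meeting its top / bottom / left / right edge
top bottom left right : Tile → Bool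
top vert = true
top cross = true
top jelbow = true
top _ = false
bottom vert = true
bottom cross = true
bottom relbow = true
bottom _ = false
left horiz = true
left cross = true
left jelbow = true
left _ = false
right horiz = true
right cross = true
right relbow = true
right _ = false

-- k × n grid of tiles; rows 0..k-1 from the top, columns 0..n-1 from the left
Grid : ℕ → ℕ → Set
Grid k n = Fin k → Fin n → Tile

PassH : Tile → Set
PassH t = (t ≡ horiz) ⊎ (t ≡ cross)

PassV : Tile → Set
PassV t = (t ≡ vert) ⊎ (t ≡ cross)

-- side through which a pipe (traced backwards from the right boundary) enters a tile
data Side : Set where
  fromRight fromTop : Side

-- Trace D p s i j : the pipe from row p passes through the s-edge of tile (i,j)
-- (traced backwards from the right edge of column n in row p)
data Trace {k n : ℕ} (D : Grid k n) (p : Fin k) : Side → Fin k → Fin n → Set where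
  start  : ∀ j → suc (toℕ j) ≡ n → Trace D p fromRight p j
  goLeft : ∀ {i j j'} → Trace D p fromRight i j → PassH (D i j) →
           suc (toℕ j') ≡ toℕ j → Trace D p fromRight i j'
  rTurn  : ∀ {i i' j} → Trace D p fromRight i j → D i j ≡ relbow →
           suc (toℕ i) ≡ toℕ i' → Trace D p fromTop i' j
  goDown : ∀ {i i' j} → Trace D p fromTop i j → PassV (D i j) →
           suc (toℕ i) ≡ toℕ i' → Trace D p fromTop i' j
  jTurn  : ∀ {i j j'} → Trace D p fromTop i j → D i j ≡ jelbow →
           suc (toℕ j') ≡ toℕ j → Trace D p fromRight i j'

ExitsBottom : ∀ {k n} → Grid k n → Fin k → Fin n → Set
ExitsBottom {k} D p j = Σ (Fin k) λ i → suc (toℕ i) ≡ k ×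
  ((Trace D p fromRight i j × D i j ≡ relbow) ⊎ (Trace D p fromTop i j × PassV (D i j)))

Crosses : ∀ {k n} → Grid k n → Fin k → Fin k → Fin k → Fin n → Set
Crosses D p q i j = D i j ≡ cross ×
  ((Trace D p fromRight i j × Trace D q fromTop i j) ⊎
   (Trace D p fromTop i j × Trace D q fromRight i j))

record IsBPD {k n : ℕ} (D : Grid k n) : Set where
  field
    horizConsistent : ∀ i (j j' : Fin n) → suc (toℕ j) ≡ toℕ j' → right (D i j) ≡ left (D i j')
    vertConsistent  : ∀ (i i' : Fin k) j → suc (toℕ i) ≡ toℕ i' → bottom (D i j) ≡ top (D i' j)
    topEmpty        : ∀ i j → toℕ i ≡ 0 → top (D i j) ≡ false
    leftEmpty       : ∀ i j → toℕ j ≡ 0 → left (D i j) ≡ false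
    rightFull       : ∀ i j → suc (toℕ j) ≡ n → right (D i j) ≡ true
    crossOnce       : ∀ p q → p ≢ q → ∀ i j i' j' →
                      Crosses D p q i j → Crosses D p q i' j' → (i ≡ i') × (j ≡ j')

-- v is the permutation associated with the k-row BPD D (positions 0-indexed)
AssocPerm : ∀ {k n} → Grid k n → Permutation′ n → Set
AssocPerm {k} {n} D v =
  (∀ (p : Fin k) (x : Fin n) → toℕ x ≡ toℕ p → ExitsBottom D p (v ⟨$⟩ʳ x)) ×
  (∀ (x y : Fin n) → k ≤ toℕ x → toℕ x < toℕ y → toℕ (v ⟨$⟩ʳ y) < toℕ (v ⟨$⟩ʳ x))

restrict : ∀ {k n} → Grid (suc k) n → Grid k n
restrict D i j = D (inject₁ i) j

Fun : ℕ → Set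
Fun n = Fin n → Fin n

inv : ∀ {n} → Fun n → ℕ
inv {n} v = sum (map (λ i → sum (map (λ j →
  if (toℕ i <ᵇ toℕ j) ∧ (toℕ (v j) <ᵇ toℕ (v i)) then 1 else 0) (allFin n))) (allFin n))

_·t[_,_] : ∀ {n} → Fun n → Fin n → Fin n → Fun n
(v ·t[ a , b ]) x = v (transpose a b ⟨$⟩ʳ x)

-- v ⋖_k v' witnessed by v' = v t_{a,b}, with a ≤ k < b in 1-indexed positions
CoverBy : ∀ {n} → ℕ → Fun n → Fun n → Fin n → Fin n → Set
CoverBy k v v' a b = toℕ a < k × k ≤ toℕ b ×
  (∀ x → v' x ≡ (v ·t[ a , b ]) x) × inv v' ≡ suc (inv v)

smallerSwapped : ∀ {n} → Fun n → Fin n → Fin n → ℕ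
smallerSwapped v a b = toℕ (v a) ⊓ toℕ (v b)

-- (v_0,…,v_{d-1}) is an increasing k-chain; a i, b i are the positions swapped
-- in the step from v i to v (i+1) (the values at the last index are unused)
IncChain : ∀ {n d} → ℕ → (Fin d → Fun n) → Set
IncChain {n} {d} k v = Σ (Fin d → Fin n) λ a → Σ (Fin d → Fin n) λ b →
  (∀ (i i' : Fin d) → suc (toℕ i) ≡ toℕ i' → CoverBy k (v i) (v i') (a i) (b i)) ×
  (∀ (i i' i'' : Fin d) → suc (toℕ i) ≡ toℕ i' → suc (toℕ i') ≡ toℕ i'' →
     smallerSwapped (v i) (a i) (b i) < smallerSwapped (v i') (a i') (b i'))

-- W (last) = w ;  W i = W (i+1) t_i   (T i is the function of the i-th transposition)
chainFrom : ∀ {n m} → Fun n → (Fin m → Fun n) → Fin m → Fun n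
chainFrom {m = zero} w T ()
chainFrom {m = suc zero} w T zero = w
chainFrom {m = suc (suc m)} w T zero = λ x → chainFrom w (λ i → T (suc i)) zero (T zero x)
chainFrom {m = suc (suc m)} w T (suc i) = chainFrom w (λ i → T (suc i)) i

StrictInc : ∀ {m n} → (Fin m → Fin n) → Set
StrictInc c = ∀ i j → toℕ i < toℕ j → toℕ (c i) < toℕ (c j)

HorOrR : Tile → Set
HorOrR t = (t ≡ horiz) ⊎ (t ≡ relbow)

-- Follow row k of D from the right.  The pipe r t reaches the tile (k, c t) after passing only
-- crosses since its previous horizontal tile, which is c (t + 1), or since the j-elbow where it
-- entered row k, at column w (r t); call that column z.  By downward induction on t, the chain
-- satisfies W t (r t) = c t and W t (w⁻¹ (c t)) = z, so the t-th step exchanges the values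
-- c t < z, and the smaller swapped values c 1 < c 2 < ⋯ increase.  A value strictly between
-- c t and z is a cross on pipe r t; its vertical pipe comes from a row q < r t, since otherwise
-- the two pipes would already cross in the first k - 1 rows, so that value sits at position
-- q < r t and the transposition raises ℓ by exactly one.  Finally W 1 agrees with u on the first
-- k positions, because pipe p leaves row k at the leftmost column c t with r t = p or drops
-- straight through, and W 1 is decreasing after position k, like u; hence W 1 = u.

module Submission where

open import Defs
open import Data.Bool using (Bool; true; false; _∧_; if_then_else_)
open import Data.Bool.Properties using (T-≡)
open import Data.Empty using (⊥-elim)
open import Data.Fin using (Fin; zero; suc; toℕ; fromℕ; fromℕ<; inject₁; inject≤; punchIn; punchOut)
open import Data.Fin.Induction using (>-weakInduction)
open import Data.Fin.Properties using (toℕ-injective; toℕ<n; toℕ-fromℕ<; toℕ-fromℕ; toℕ-inject₁; toℕ-inject≤;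
  punchInᵢ≢i; punchIn-punchOut; punchIn-injective) renaming (_≟_ to _≟ᶠ_)
open import Data.Fin.Permutation using (Permutation′; _⟨$⟩ʳ_; _⟨$⟩ˡ_; transpose; inverseˡ; inverseʳ)
import Data.Fin.Permutation.Components as PC
open import Data.List using (map; allFin; tabulate)
import Data.Nat.ListAction as List
open import Data.Nat using (ℕ; zero; suc; _<_; _≤_; _+_; _∸_; _⊓_; _<ᵇ_; _<?_; _≤?_; _≟_; z≤n; z<s; s≤s; s≤s⁻¹)
open import Data.Nat.Properties hiding (_≟_)
open import Algebra.Properties.CommutativeMonoid.Sum +-0-commutativeMonoid using (sum; sum-remove; sum-cong-≗; ∑-distrib-+)
open import Data.Nat.Tactic.RingSolver using (solve-∀)
open import Data.Product using (Σ; _×_; _,_; ∃; proj₁; proj₂)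
open import Data.Sum using (_⊎_; inj₁; inj₂)
open import Function using (_∘_)
open import Function.Bundles using (Equivalence)
open import Relation.Binary.Construct.Closure.ReflexiveTransitive using (Star; ε; _◅_; _◅◅_)
open import Relation.Binary.Definitions using (tri<; tri≈; tri>)
open import Relation.Nullary using (¬_; Dec; yes; no)
open import Relation.Binary.PropositionalEquality

-- Inversions

listSum-map-tabulate : ∀ {n m} (f : Fin n → ℕ) (g : Fin m → Fin n) →
                       List.sum (map f (tabulate g)) ≡ sum (f ∘ g)
listSum-map-tabulate {m = zero}  f g = refl
listSum-map-tabulate {m = suc m} f g = cong (f (g zero) +_) (listSum-map-tabulate f (g ∘ suc))

∑-agree-off₁ : ∀ {n} (f g : Fin n → ℕ) (a : Fin n) → (∀ x → x ≢ a → f x ≡ g x) →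
               sum f + g a ≡ sum g + f a
∑-agree-off₁ {suc n} f g a f≗g = begin
  sum f + g a                         ≡⟨ cong (_+ g a) (sum-remove f) ⟩
  f a + sum (f ∘ punchIn a) + g a     ≡⟨ cong (λ s → f a + s + g a) rest ⟩
  f a + sum (g ∘ punchIn a) + g a     ≡⟨ +-rotate (f a) _ (g a) ⟩
  g a + sum (g ∘ punchIn a) + f a     ≡⟨ cong (_+ f a) (sym (sum-remove g)) ⟩
  sum g + f a                         ∎
  where
  open ≡-Reasoning
  +-rotate : ∀ x y z → x + y + z ≡ z + y + x
  +-rotate = solve-∀
  rest : sum (f ∘ punchIn a) ≡ sum (g ∘ punchIn a)
  rest = sum-cong-≗ (λ x → f≗g (punchIn a x) (punchInᵢ≢i a x))

∑-agree-off₂ : ∀ {n} (f g : Fin n → ℕ) {a b : Fin n} → a ≢ b → (∀ x → x ≢ a → x ≢ b → f x ≡ g x) →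
               sum f + (g a + g b) ≡ sum g + (f a + f b)
∑-agree-off₂ {suc n} f g {a} {b} a≢b f≗g = begin
  sum f + (g a + g b)                     ≡⟨ cong (_+ (g a + g b)) (sum-remove f) ⟩
  f a + sum (f ∘ punchIn a) + (g a + g b) ≡⟨ shuffle₁ (f a) _ (g a) (g b) ⟩
  sum (f ∘ punchIn a) + g b + (f a + g a) ≡⟨ cong (_+ (f a + g a)) off-a ⟩
  sum (g ∘ punchIn a) + f b + (f a + g a) ≡⟨ shuffle₂ _ (f b) (f a) (g a) ⟩
  g a + sum (g ∘ punchIn a) + (f a + f b) ≡⟨ cong (_+ (f a + f b)) (sym (sum-remove g)) ⟩
  sum g + (f a + f b)                     ∎
  where
  open ≡-Reasoning
  shuffle₁ : ∀ x y z w → x + y + (z + w) ≡ y + w + (x + z)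
  shuffle₁ = solve-∀
  shuffle₂ : ∀ x y z w → x + y + (z + w) ≡ w + x + (z + y)
  shuffle₂ = solve-∀
  b′ : Fin n
  b′ = punchOut a≢b
  off-a : sum (f ∘ punchIn a) + g b ≡ sum (g ∘ punchIn a) + f b
  off-a with ∑-agree-off₁ (f ∘ punchIn a) (g ∘ punchIn a) b′
                (λ x x≢b′ → f≗g _ (punchInᵢ≢i a x)
                  (λ eq → x≢b′ (punchIn-injective a x b′ (trans eq (sym (punchIn-punchOut a≢b))))))
  ... | eq rewrite punchIn-punchOut a≢b = eq

<ᵇ-true : ∀ {m n} → m < n → (m <ᵇ n) ≡ true
<ᵇ-true m<n = Equivalence.to T-≡ (<⇒<ᵇ m<n)

<ᵇ-false : ∀ {m n} → ¬ m < n → (m <ᵇ n) ≡ false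
<ᵇ-false {m} {n} m≮n with m <ᵇ n in eq
... | false = refl
... | true  = ⊥-elim (m≮n (<ᵇ⇒< m n (Equivalence.from T-≡ eq)))

𝟙 : Bool → ℕ
𝟙 b = if b then 1 else 0

[_<_∧_<_] : ℕ → ℕ → ℕ → ℕ → ℕ
[ x < y ∧ p < q ] = 𝟙 ((x <ᵇ y) ∧ (p <ᵇ q))

inversionAt : ∀ {n} → Fun n → Fin n → Fin n → ℕ
inversionAt v i j = [ toℕ i < toℕ j ∧ toℕ (v j) < toℕ (v i) ]

inv≡∑∑ : ∀ {n} (v : Fun n) → inv v ≡ sum (λ i → sum (inversionAt v i))
inv≡∑∑ {n} v = trans (listSum-map-tabulate (λ i → List.sum (map (inversionAt v i) (allFin n))) (λ i → i))
                     (sum-cong-≗ (λ i → listSum-map-tabulate (inversionAt v i) (λ j → j)))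

inv-cong : ∀ {n} {v v′ : Fun n} → (∀ x → v x ≡ v′ x) → inv v ≡ inv v′
inv-cong {v = v} {v′} v≗v′ = begin
  inv v                                   ≡⟨ inv≡∑∑ v ⟩
  sum (λ i → sum (inversionAt v i))       ≡⟨ sum-cong-≗ (λ i → sum-cong-≗ (λ j →
                                             cong₂ (λ p q → [ toℕ i < toℕ j ∧ toℕ p < toℕ q ]) (v≗v′ j) (v≗v′ i))) ⟩
  sum (λ i → sum (inversionAt v′ i))      ≡⟨ inv≡∑∑ v′ ⟨
  inv v′                                  ∎
  where open ≡-Reasoning

∑-shift-off₂ : ∀ {n} (f g : Fin n → ℕ) {a b : Fin n} (d : ℕ) → a ≢ b →
               (∀ x → x ≢ a → x ≢ b → f x ≡ g x) → f a + f b ≡ d + (g a + g b) →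
               sum f ≡ d + sum g
∑-shift-off₂ f g {a} {b} d a≢b f≗g ab = +-cancelʳ-≡ (g a + g b) _ _ (begin
  sum f + (g a + g b)        ≡⟨ ∑-agree-off₂ f g a≢b f≗g ⟩
  sum g + (f a + f b)        ≡⟨ cong (sum g +_) ab ⟩
  sum g + (d + (g a + g b))  ≡⟨ +-exchange (sum g) d (g a + g b) ⟩
  d + sum g + (g a + g b)    ∎)
  where
  open ≡-Reasoning
  +-exchange : ∀ x y z → x + (y + z) ≡ y + x + z
  +-exchange = solve-∀

transpose-fst : ∀ {n} (a b : Fin n) → PC.transpose a b a ≡ b
transpose-fst a b with a ≟ᶠ a
... | yes _ = refl
... | no a≢a = ⊥-elim (a≢a refl)

transpose-snd : ∀ {n} (a b : Fin n) → PC.transpose a b b ≡ a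
transpose-snd a b with b ≟ᶠ a
... | yes b≡a = b≡a
... | no _ with b ≟ᶠ b
...   | yes _ = refl
...   | no b≢b = ⊥-elim (b≢b refl)

transpose-other : ∀ {n} (a b x : Fin n) → x ≢ a → x ≢ b → PC.transpose a b x ≡ x
transpose-other a b x x≢a x≢b with x ≟ᶠ a
... | yes x≡a = ⊥-elim (x≢a x≡a)
... | no _ with x ≟ᶠ b
...   | yes x≡b = ⊥-elim (x≢b x≡b)
...   | no _ = refl

transpose-involutive : ∀ {n} (a b x : Fin n) → PC.transpose a b (PC.transpose a b x) ≡ x
transpose-involutive a b x with x ≟ᶠ a
... | yes refl = transpose-snd x b
... | no x≢a with x ≟ᶠ b
...   | yes refl = transpose-fst a x
...   | no x≢b = transpose-other a b x x≢a x≢b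

-- Inversions among the pairs meeting positions A < B, before and after exchanging their values va < vb.
module _ {A B va vb : ℕ} (A<B : A < B) (va<vb : va < vb) where

  swap-row-pair : ∀ I vi → I ≢ A → I ≢ B → (A < I → I < B → vi < va ⊎ vb < vi) →
                  [ I < A ∧ vb < vi ] + [ I < B ∧ va < vi ] ≡ [ I < A ∧ va < vi ] + [ I < B ∧ vb < vi ]
  swap-row-pair I vi I≢A I≢B between with I <? A | I <? B
  ... | yes I<A | yes I<B rewrite <ᵇ-true I<A | <ᵇ-true I<B =
    +-comm (𝟙 (vb <ᵇ vi)) (𝟙 (va <ᵇ vi))
  ... | yes I<A | no I≮B = ⊥-elim (I≮B (<-trans I<A A<B))
  ... | no I≮A | no I≮B rewrite <ᵇ-false I≮A | <ᵇ-false I≮B = refl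
  ... | no I≮A | yes I<B rewrite <ᵇ-false I≮A | <ᵇ-true I<B
    with between (≤∧≢⇒< (≮⇒≥ I≮A) (I≢A ∘ sym)) I<B
  ...   | inj₁ vi<va rewrite <ᵇ-false (<⇒≯ vi<va) | <ᵇ-false (<⇒≯ (<-trans vi<va va<vb)) = refl
  ...   | inj₂ vb<vi rewrite <ᵇ-true vb<vi | <ᵇ-true (<-trans va<vb vb<vi) = refl

  swap-column-pair : ∀ J vj → J ≢ A → J ≢ B → (A < J → J < B → vj < va ⊎ vb < vj) →
                     [ A < J ∧ vj < vb ] + [ B < J ∧ vj < va ] ≡ [ A < J ∧ vj < va ] + [ B < J ∧ vj < vb ]
  swap-column-pair J vj J≢A J≢B between with A <? J | B <? J
  ... | yes A<J | yes B<J rewrite <ᵇ-true A<J | <ᵇ-true B<J =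
    +-comm (𝟙 (vj <ᵇ vb)) (𝟙 (vj <ᵇ va))
  ... | no A≮J | yes B<J = ⊥-elim (A≮J (<-trans A<B B<J))
  ... | no A≮J | no B≮J rewrite <ᵇ-false A≮J | <ᵇ-false B≮J = refl
  ... | yes A<J | no B≮J rewrite <ᵇ-true A<J | <ᵇ-false B≮J
    with between A<J (≤∧≢⇒< (≮⇒≥ B≮J) J≢B)
  ...   | inj₁ vj<va rewrite <ᵇ-true vj<va | <ᵇ-true (<-trans vj<va va<vb) = refl
  ...   | inj₂ vb<vj rewrite <ᵇ-false (<⇒≯ vb<vj) | <ᵇ-false (<⇒≯ (<-trans va<vb vb<vj)) = refl

  swap-block : ([ A < A ∧ vb < vb ] + [ B < A ∧ vb < va ]) + ([ A < B ∧ va < vb ] + [ B < B ∧ va < va ]) ≡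
               1 + (([ A < A ∧ va < va ] + [ B < A ∧ va < vb ]) + ([ A < B ∧ vb < va ] + [ B < B ∧ vb < vb ]))
  swap-block rewrite <ᵇ-false (<-irrefl {A} refl) | <ᵇ-false (<-irrefl {B} refl)
    | <ᵇ-false (<⇒≯ A<B) | <ᵇ-true A<B | <ᵇ-true va<vb | <ᵇ-false (<⇒≯ va<vb) = refl

inv-transpose : ∀ {n} (v : Fun n) {a b : Fin n} → toℕ a < toℕ b → toℕ (v a) < toℕ (v b) →
  (∀ x → toℕ a < toℕ x → toℕ x < toℕ b → toℕ (v x) < toℕ (v a) ⊎ toℕ (v b) < toℕ (v x)) →
  inv (v ·t[ a , b ]) ≡ suc (inv v)
inv-transpose {n} v {a} {b} a<b va<vb between = begin
  inv vt                                    ≡⟨ inv≡∑∑ vt ⟩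
  sum (λ i → sum (inversionAt vt i))        ≡⟨ ∑-shift-off₂ _ _ 1 a≢b rows-off rows-ab ⟩
  1 + sum (λ i → sum (inversionAt v i))     ≡⟨ cong suc (inv≡∑∑ v) ⟨
  suc (inv v)                               ∎
  where
  open ≡-Reasoning
  vt : Fun n
  vt = v ·t[ a , b ]
  a≢b : a ≢ b
  a≢b a≡b = <-irrefl (cong toℕ a≡b) a<b

  rows-off : ∀ i → i ≢ a → i ≢ b → sum (inversionAt vt i) ≡ sum (inversionAt v i)
  rows-off i i≢a i≢b = ∑-shift-off₂ _ _ 0 a≢b entries-off row-pair
    where
    entries-off : ∀ j → j ≢ a → j ≢ b → inversionAt vt i j ≡ inversionAt v i j
    entries-off j j≢a j≢b rewrite transpose-other a b j j≢a j≢b | transpose-other a b i i≢a i≢b = refl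
    row-pair : inversionAt vt i a + inversionAt vt i b ≡ 0 + (inversionAt v i a + inversionAt v i b)
    row-pair rewrite transpose-fst a b | transpose-snd a b | transpose-other a b i i≢a i≢b =
      swap-row-pair a<b va<vb (toℕ i) (toℕ (v i)) (i≢a ∘ toℕ-injective) (i≢b ∘ toℕ-injective) (between i)

  rows-ab : sum (inversionAt vt a) + sum (inversionAt vt b) ≡
            1 + (sum (inversionAt v a) + sum (inversionAt v b))
  rows-ab = begin
    sum (inversionAt vt a) + sum (inversionAt vt b)        ≡⟨ ∑-distrib-+ (inversionAt vt a) (inversionAt vt b) ⟨
    sum (λ j → inversionAt vt a j + inversionAt vt b j)    ≡⟨ ∑-shift-off₂ _ _ 1 a≢b columns-off block ⟩
    1 + sum (λ j → inversionAt v a j + inversionAt v b j)  ≡⟨ cong suc (∑-distrib-+ (inversionAt v a) (inversionAt v b)) ⟩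
    1 + (sum (inversionAt v a) + sum (inversionAt v b))    ∎
    where
    columns-off : ∀ j → j ≢ a → j ≢ b →
                  inversionAt vt a j + inversionAt vt b j ≡ inversionAt v a j + inversionAt v b j
    columns-off j j≢a j≢b rewrite transpose-fst a b | transpose-snd a b | transpose-other a b j j≢a j≢b =
      swap-column-pair a<b va<vb (toℕ j) (toℕ (v j)) (j≢a ∘ toℕ-injective) (j≢b ∘ toℕ-injective) (between j)
    block : (inversionAt vt a a + inversionAt vt b a) + (inversionAt vt a b + inversionAt vt b b) ≡
            1 + ((inversionAt v a a + inversionAt v b a) + (inversionAt v a b + inversionAt v b b))
    block rewrite transpose-fst a b | transpose-snd a b = swap-block a<b va<vb

-- Tiles and positions

true≢false : true ≢ false
true≢false ()

∃-predecessor : ∀ {n} (j : Fin n) → toℕ j ≢ 0 → Σ (Fin n) λ j′ → suc (toℕ j′) ≡ toℕ j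
∃-predecessor {n} j j≢0 with toℕ j in eq
... | zero = ⊥-elim (j≢0 refl)
... | suc a = fromℕ< {a} (<-trans (n<1+n a) (subst (_< n) eq (toℕ<n j))) , cong suc (toℕ-fromℕ< _)

∃-successor : ∀ {n} (j : Fin n) → suc (toℕ j) < n → Σ (Fin n) λ j′ → suc (toℕ j) ≡ toℕ j′
∃-successor j lt = fromℕ< lt , sym (toℕ-fromℕ< lt)

≤-last : ∀ {n} {j : Fin n} (y : Fin n) → suc (toℕ j) ≡ n → toℕ y ≤ toℕ j
≤-last y e = ≤-pred (≤-trans (toℕ<n y) (≤-reflexive (sym e)))

∃-last-column : ∀ {n} → 0 < n → Σ (Fin n) λ j → suc (toℕ j) ≡ n
∃-last-column {suc n} _ = fromℕ n , cong suc (toℕ-fromℕ n)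

successor-unique : ∀ {n} {x y y′ : Fin n} → suc (toℕ x) ≡ toℕ y → suc (toℕ x) ≡ toℕ y′ → y ≡ y′
successor-unique e e′ = toℕ-injective (trans (sym e) e′)

predecessor-unique : ∀ {n} {x x′ y : Fin n} → suc (toℕ x) ≡ toℕ y → suc (toℕ x′) ≡ toℕ y → x ≡ x′
predecessor-unique e e′ = toℕ-injective (suc-injective (trans e (sym e′)))

passH≢relbow : ∀ {t} → PassH t → t ≢ relbow
passH≢relbow (inj₁ refl) ()
passH≢relbow (inj₂ refl) ()

passH≢jelbow : ∀ {t} → PassH t → t ≢ jelbow
passH≢jelbow (inj₁ refl) ()
passH≢jelbow (inj₂ refl) ()

passV≢relbow : ∀ {t} → PassV t → t ≢ relbow
passV≢relbow (inj₁ refl) ()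
passV≢relbow (inj₂ refl) ()

passV≢jelbow : ∀ {t} → PassV t → t ≢ jelbow
passV≢jelbow (inj₁ refl) ()
passV≢jelbow (inj₂ refl) ()

passH-top⇒cross : ∀ {t} → PassH t → top t ≡ true → t ≡ cross
passH-top⇒cross (inj₂ refl) _ = refl
passH-top⇒cross (inj₁ refl) ()

right⇒passH⊎relbow : ∀ t → right t ≡ true → PassH t ⊎ t ≡ relbow
right⇒passH⊎relbow horiz  _ = inj₁ (inj₁ refl)
right⇒passH⊎relbow cross  _ = inj₁ (inj₂ refl)
right⇒passH⊎relbow relbow _ = inj₂ refl
right⇒passH⊎relbow blank  ()
right⇒passH⊎relbow vert   ()
right⇒passH⊎relbow jelbow ()

top⇒passV⊎jelbow : ∀ t → top t ≡ true → PassV t ⊎ t ≡ jelbow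
top⇒passV⊎jelbow vert   _ = inj₁ (inj₁ refl)
top⇒passV⊎jelbow cross  _ = inj₁ (inj₂ refl)
top⇒passV⊎jelbow jelbow _ = inj₂ refl
top⇒passV⊎jelbow blank  ()
top⇒passV⊎jelbow horiz  ()
top⇒passV⊎jelbow relbow ()

left⇒passH⊎jelbow : ∀ t → left t ≡ true → PassH t ⊎ t ≡ jelbow
left⇒passH⊎jelbow horiz  _ = inj₁ (inj₁ refl)
left⇒passH⊎jelbow cross  _ = inj₁ (inj₂ refl)
left⇒passH⊎jelbow jelbow _ = inj₂ refl
left⇒passH⊎jelbow blank  ()
left⇒passH⊎jelbow vert   ()
left⇒passH⊎jelbow relbow ()

bottom⇒passV⊎relbow : ∀ t → bottom t ≡ true → PassV t ⊎ t ≡ relbow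
bottom⇒passV⊎relbow vert   _ = inj₁ (inj₁ refl)
bottom⇒passV⊎relbow cross  _ = inj₁ (inj₂ refl)
bottom⇒passV⊎relbow relbow _ = inj₂ refl
bottom⇒passV⊎relbow blank  ()
bottom⇒passV⊎relbow horiz  ()
bottom⇒passV⊎relbow jelbow ()

passH-left : ∀ {t} → PassH t → left t ≡ true
passH-left (inj₁ refl) = refl
passH-left (inj₂ refl) = refl

passH-right : ∀ {t} → PassH t → right t ≡ true
passH-right (inj₁ refl) = refl
passH-right (inj₂ refl) = refl

passV-top : ∀ {t} → PassV t → top t ≡ true
passV-top (inj₁ refl) = refl
passV-top (inj₂ refl) = refl

passV-bottom : ∀ {t} → PassV t → bottom t ≡ true
passV-bottom (inj₁ refl) = refl
passV-bottom (inj₂ refl) = refl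

jelbow-left : ∀ {t} → t ≡ jelbow → left t ≡ true
jelbow-left refl = refl

jelbow-top : ∀ {t} → t ≡ jelbow → top t ≡ true
jelbow-top refl = refl

relbow-right : ∀ {t} → t ≡ relbow → right t ≡ true
relbow-right refl = refl

relbow-bottom : ∀ {t} → t ≡ relbow → bottom t ≡ true
relbow-bottom refl = refl

relbow-top : ∀ {t} → t ≡ relbow → top t ≡ false
relbow-top refl = refl

cross-top : ∀ {t} → t ≡ cross → top t ≡ true
cross-top refl = refl

HorOrR-top : ∀ {t} → HorOrR t → top t ≡ false
HorOrR-top (inj₁ refl) = refl
HorOrR-top (inj₂ refl) = refl

HorOrR≢cross : ∀ {t} → HorOrR t → t ≢ cross
HorOrR≢cross (inj₁ refl) ()
HorOrR≢cross (inj₂ refl) ()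

HorOrR≢jelbow : ∀ {t} → HorOrR t → t ≢ jelbow
HorOrR≢jelbow (inj₁ refl) ()
HorOrR≢jelbow (inj₂ refl) ()

HorOrR? : ∀ t → Dec (HorOrR t)
HorOrR? horiz  = yes (inj₁ refl)
HorOrR? relbow = yes (inj₂ refl)
HorOrR? blank  = no λ { (inj₁ ()) ; (inj₂ ()) }
HorOrR? vert   = no λ { (inj₁ ()) ; (inj₂ ()) }
HorOrR? cross  = no λ { (inj₁ ()) ; (inj₂ ()) }
HorOrR? jelbow = no λ { (inj₁ ()) ; (inj₂ ()) }

-- Pipes

data State (h n : ℕ) : Set where
  state : Side → Fin h → Fin n → State h n

column : ∀ {h n} → State h n → Fin n
column (state _ _ j) = j

module Pipes {h n : ℕ} (G : Grid h n) (bpd : IsBPD G) where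
  open IsBPD bpd

  -- The steps of Trace as a relation on states, so that points of one pipe can be compared by reachability.
  data Move : State h n → State h n → Set where
    moveLeft : ∀ {i j j′} → PassH (G i j) → suc (toℕ j′) ≡ toℕ j → Move (state fromRight i j) (state fromRight i j′)
    turnDown : ∀ {i i′ j} → G i j ≡ relbow → suc (toℕ i) ≡ toℕ i′ → Move (state fromRight i j) (state fromTop i′ j)
    moveDown : ∀ {i i′ j} → PassV (G i j) → suc (toℕ i) ≡ toℕ i′ → Move (state fromTop i j) (state fromTop i′ j)
    turnLeft : ∀ {i j j′} → G i j ≡ jelbow → suc (toℕ j′) ≡ toℕ j → Move (state fromTop i j) (state fromRight i j′)

  Reaches : State h n → State h n → Set
  Reaches = Star Move

  move-deterministic : ∀ {σ σ₁ σ₂} → Move σ σ₁ → Move σ σ₂ → σ₁ ≡ σ₂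
  move-deterministic (moveLeft _ e) (moveLeft _ e′) = cong (state fromRight _) (predecessor-unique e e′)
  move-deterministic (moveLeft p _) (turnDown q _)  = ⊥-elim (passH≢relbow p q)
  move-deterministic (turnDown q _) (moveLeft p _)  = ⊥-elim (passH≢relbow p q)
  move-deterministic (turnDown _ e) (turnDown _ e′) = cong (λ i → state fromTop i _) (successor-unique e e′)
  move-deterministic (moveDown _ e) (moveDown _ e′) = cong (λ i → state fromTop i _) (successor-unique e e′)
  move-deterministic (moveDown p _) (turnLeft q _)  = ⊥-elim (passV≢jelbow p q)
  move-deterministic (turnLeft q _) (moveDown p _)  = ⊥-elim (passV≢jelbow p q)
  move-deterministic (turnLeft _ e) (turnLeft _ e′) = cong (state fromRight _) (predecessor-unique e e′)

  reaches-linear : ∀ {σ σ₁ σ₂} → Reaches σ σ₁ → Reaches σ σ₂ → Reaches σ₁ σ₂ ⊎ Reaches σ₂ σ₁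
  reaches-linear ε r₂ = inj₁ r₂
  reaches-linear (m ◅ r₁) ε = inj₂ (m ◅ r₁)
  reaches-linear (m₁ ◅ r₁) (m₂ ◅ r₂) with move-deterministic m₁ m₂
  ... | refl = reaches-linear r₁ r₂

  FromStart : Fin h → State h n → Set
  FromStart p σ = Σ (Fin n) λ j₀ → suc (toℕ j₀) ≡ n × Reaches (state fromRight p j₀) σ

  _▷_ : ∀ {p σ σ′} → FromStart p σ → Move σ σ′ → FromStart p σ′
  (j₀ , e₀ , r) ▷ m = j₀ , e₀ , r ◅◅ (m ◅ ε)

  trace⇒fromStart : ∀ {p s i j} → Trace G p s i j → FromStart p (state s i j)
  trace⇒fromStart (start j e)    = j , e , ε
  trace⇒fromStart (goLeft t p e) = trace⇒fromStart t ▷ moveLeft p e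
  trace⇒fromStart (rTurn t q e)  = trace⇒fromStart t ▷ turnDown q e
  trace⇒fromStart (goDown t p e) = trace⇒fromStart t ▷ moveDown p e
  trace⇒fromStart (jTurn t q e)  = trace⇒fromStart t ▷ turnLeft q e

  trace-linear : ∀ {p s i j s′ i′ j′} → Trace G p s i j → Trace G p s′ i′ j′ →
                 Reaches (state s i j) (state s′ i′ j′) ⊎ Reaches (state s′ i′ j′) (state s i j)
  trace-linear t₁ t₂ with trace⇒fromStart t₁ | trace⇒fromStart t₂
  ... | j₀ , e₀ , r₁ | j₁ , e₁ , r₂ with toℕ-injective {i = j₀} {j = j₁} (suc-injective (trans e₀ (sym e₁)))
  ... | refl = reaches-linear r₁ r₂

  trace-right : ∀ {p i j} → Trace G p fromRight i j → right (G i j) ≡ true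
  trace-right (start j e)                 = rightFull _ j e
  trace-right (goLeft {i} {j} {j′} _ p e) = trans (horizConsistent i j′ j e) (passH-left p)
  trace-right (jTurn {i} {j} {j′} _ q e)  = trans (horizConsistent i j′ j e) (jelbow-left q)

  trace-top : ∀ {p i j} → Trace G p fromTop i j → top (G i j) ≡ true
  trace-top (rTurn {i} {i′} {j} _ q e)  = trans (sym (vertConsistent i i′ j e)) (relbow-bottom q)
  trace-top (goDown {i} {i′} {j} _ p e) = trans (sym (vertConsistent i i′ j e)) (passV-bottom p)

  fromTop-not-HorOrR : ∀ {p i j} → Trace G p fromTop i j → ¬ HorOrR (G i j)
  fromTop-not-HorOrR t hr = true≢false (trans (sym (trace-top t)) (HorOrR-top hr))

  LeavesDown : Fin h → Fin h → Fin n → Set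
  LeavesDown p i x = (Trace G p fromRight i x × G i x ≡ relbow) ⊎ (Trace G p fromTop i x × PassV (G i x))

  enter-below : ∀ {p i i′ x} → LeavesDown p i x → suc (toℕ i) ≡ toℕ i′ → Trace G p fromTop i′ x
  enter-below (inj₁ (t , q)) e = rTurn t q e
  enter-below (inj₂ (t , q)) e = goDown t q e

  walk-to-relbow : ∀ {p i j} → Trace G p fromRight i j →
                   Σ (Fin n) λ x → toℕ x ≤ toℕ j × Trace G p fromRight i x × G i x ≡ relbow
  walk-to-relbow {j = j} = walk (suc (toℕ j)) ≤-refl
    where
    walk : (fuel : ℕ) → ∀ {p i j} → toℕ j < fuel → Trace G p fromRight i j →
           Σ (Fin n) λ x → toℕ x ≤ toℕ j × Trace G p fromRight i x × G i x ≡ relbow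
    walk (suc fuel) {i = i} {j} j<fuel t with right⇒passH⊎relbow (G i j) (trace-right t)
    ... | inj₂ q = j , ≤-refl , t , q
    ... | inj₁ p with ∃-predecessor j (λ j≡0 → true≢false (trans (sym (passH-left p)) (leftEmpty i j j≡0)))
    ...   | j′ , e with walk fuel (≤-trans (≤-reflexive e) (s≤s⁻¹ j<fuel)) (goLeft t p e)
    ...     | x , x≤j′ , t′ , q = x , ≤-trans x≤j′ (<⇒≤ (≤-reflexive e)) , t′ , q

  leave-row-fromRight : ∀ {p i j} → Trace G p fromRight i j →
                        Σ (Fin n) λ x → toℕ x ≤ toℕ j × LeavesDown p i x
  leave-row-fromRight t with walk-to-relbow t
  ... | x , x≤j , t′ , q = x , x≤j , inj₁ (t′ , q)

  leave-row-fromTop : ∀ {p i j} → Trace G p fromTop i j →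
                      Σ (Fin n) λ x → toℕ x ≤ toℕ j × LeavesDown p i x
  leave-row-fromTop {i = i} {j} t with top⇒passV⊎jelbow (G i j) (trace-top t)
  ... | inj₁ p = j , ≤-refl , inj₂ (t , p)
  ... | inj₂ q with ∃-predecessor j (λ j≡0 → true≢false (trans (sym (jelbow-left q)) (leftEmpty i j j≡0)))
  ...   | j′ , e with leave-row-fromRight (jTurn t q e)
  ...     | x , x≤j′ , l = x , ≤-trans x≤j′ (<⇒≤ (≤-reflexive e)) , l

  descend : ∀ {p i i′ j} → Trace G p fromTop i j → suc (toℕ i) ≡ toℕ i′ →
            Σ (Fin n) λ x → toℕ x ≤ toℕ j × Trace G p fromTop i′ x
  descend t e with leave-row-fromTop t
  ... | x , x≤j , l = x , x≤j , enter-below l e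

  enters-below : ∀ {r} (j₀ : Fin n) → suc (toℕ j₀) ≡ n → ∀ i → toℕ r < toℕ i →
                 Σ (Fin n) λ j → Trace G r fromTop i j
  enters-below {r} j₀ e₀ i r<i = go (toℕ i) i refl r<i
    where
    go : ∀ f i → toℕ i ≡ f → toℕ r < f → Σ (Fin n) λ j → Trace G r fromTop i j
    go (suc f) i i≡f r<f with ∃-predecessor i (λ i≡0 → 0≢1+n (trans (sym i≡0) i≡f))
    ... | i′ , e with toℕ r ≟ f
    ...   | yes r≡f with toℕ-injective {i = r} {j = i′} (trans r≡f (suc-injective (trans (sym i≡f) (sym e))))
    ...     | refl with leave-row-fromRight (start j₀ e₀)
    ...       | x , _ , l = x , enter-below l e
    go (suc f) i i≡f r<f | i′ , e | no r≢f with go f i′ (suc-injective (trans e i≡f)) (≤∧≢⇒< (s≤s⁻¹ r<f) r≢f)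
    ...       | j , t with descend t e
    ...         | x , _ , t′ = x , t′

  pipe-fromTop : (i : Fin h) (j : Fin n) → top (G i j) ≡ true → Σ (Fin h) λ p → Trace G p fromTop i j
  pipe-fromTop i j = backTop (toℕ i) i j refl
    where
    -- follow the pipe backwards: each step goes up a row, or right within the row
    backTop : (a : ℕ) (i : Fin h) (j : Fin n) → toℕ i ≡ a → top (G i j) ≡ true →
              Σ (Fin h) λ p → Trace G p fromTop i j
    backRight : (a b : ℕ) (i : Fin h) (j : Fin n) → toℕ i ≡ a → suc (toℕ j) + b ≡ n → right (G i j) ≡ true →
                Σ (Fin h) λ p → Trace G p fromRight i j
    backTop zero i j e tp = ⊥-elim (true≢false (trans (sym tp) (topEmpty i j e)))
    backTop (suc a) i j e tp with ∃-predecessor i (λ e₀ → 0≢1+n (trans (sym e₀) e))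
    ... | i′ , e′ with bottom⇒passV⊎relbow (G i′ j) (trans (vertConsistent i′ i j e′) tp)
    ...   | inj₁ p with backTop a i′ j (suc-injective (trans e′ e)) (passV-top p)
    ...     | r , t = r , goDown t p e′
    backTop (suc a) i j e tp | i′ , e′ | inj₂ q
      with backRight a (n ∸ suc (toℕ j)) i′ j (suc-injective (trans e′ e)) (m+[n∸m]≡n (toℕ<n j)) (relbow-right q)
    ...     | r , t = r , rTurn t q e′
    backRight a zero i j ea eb rt = i , start j (trans (sym (+-identityʳ _)) eb)
    backRight a (suc b) i j ea eb rt
      with ∃-successor j (≤-trans (s≤s (m≤m+n (suc (toℕ j)) b)) (≤-reflexive (trans (sym (+-suc _ b)) eb)))
    ... | j′ , e with left⇒passH⊎jelbow (G i j′) (trans (sym (horizConsistent i j j′ e)) rt)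
    ...   | inj₁ p
      with backRight a b i j′ ea (trans (cong (λ z → suc z + b) (sym e)) (trans (sym (+-suc _ b)) eb)) (passH-right p)
    ...     | r , t = r , goLeft t p e
    backRight a (suc b) i j ea eb rt | j′ , e | inj₂ q with backTop a i j′ ea (jelbow-top q)
    ...     | r , t = r , jTurn t q e

  trace-pipe-unique : ∀ {p q s i j} → Trace G p s i j → Trace G q s i j → p ≡ q
  trace-pipe-unique (start j e) (start .j e′) = refl
  trace-pipe-unique (start j e) (goLeft {j = j₁} _ _ e′) = ⊥-elim (<-irrefl (trans (sym e′) e) (toℕ<n j₁))
  trace-pipe-unique (start j e) (jTurn {j = j₁} _ _ e′)  = ⊥-elim (<-irrefl (trans (sym e′) e) (toℕ<n j₁))
  trace-pipe-unique (goLeft {j = j₁} _ _ e′) (start j e) = ⊥-elim (<-irrefl (trans (sym e′) e) (toℕ<n j₁))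
  trace-pipe-unique (jTurn {j = j₁} _ _ e′) (start j e)  = ⊥-elim (<-irrefl (trans (sym e′) e) (toℕ<n j₁))
  trace-pipe-unique (goLeft t₁ _ e₁) (goLeft t₂ _ e₂) with successor-unique e₁ e₂
  ... | refl = trace-pipe-unique t₁ t₂
  trace-pipe-unique (goLeft _ p e₁) (jTurn _ q e₂) with successor-unique e₁ e₂
  ... | refl = ⊥-elim (passH≢jelbow p q)
  trace-pipe-unique (jTurn _ q e₁) (goLeft _ p e₂) with successor-unique e₁ e₂
  ... | refl = ⊥-elim (passH≢jelbow p q)
  trace-pipe-unique (jTurn t₁ _ e₁) (jTurn t₂ _ e₂) with successor-unique e₁ e₂
  ... | refl = trace-pipe-unique t₁ t₂
  trace-pipe-unique (rTurn t₁ _ e₁) (rTurn t₂ _ e₂) with predecessor-unique e₁ e₂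
  ... | refl = trace-pipe-unique t₁ t₂
  trace-pipe-unique (rTurn _ q e₁) (goDown _ p e₂) with predecessor-unique e₁ e₂
  ... | refl = ⊥-elim (passV≢relbow p q)
  trace-pipe-unique (goDown _ p e₁) (rTurn _ q e₂) with predecessor-unique e₁ e₂
  ... | refl = ⊥-elim (passV≢relbow p q)
  trace-pipe-unique (goDown t₁ _ e₁) (goDown t₂ _ e₂) with predecessor-unique e₁ e₂
  ... | refl = trace-pipe-unique t₁ t₂

  -- In the last row a pipe can only move left, and stops at an r-elbow or a PassV tile.
  module LastRow (L : Fin h) (L-last : suc (toℕ L) ≡ h) where

    no-row-below : ∀ {i′ : Fin h} → suc (toℕ L) ≢ toℕ i′
    no-row-below {i′} e = <-irrefl (trans (sym e) L-last) (toℕ<n i′)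

    fromRight-reaches : ∀ {j σ} → Reaches (state fromRight L j) σ →
                        Σ (Fin n) λ j′ → σ ≡ state fromRight L j′ × toℕ j′ ≤ toℕ j
    fromRight-reaches ε = _ , refl , ≤-refl
    fromRight-reaches (moveLeft _ e ◅ r) with fromRight-reaches r
    ... | j′ , refl , j′≤ = j′ , refl , ≤-trans j′≤ (<⇒≤ (≤-reflexive e))
    fromRight-reaches (turnDown _ e ◅ r) = ⊥-elim (no-row-below e)

    fromTop-reaches : ∀ {j σ} → Reaches (state fromTop L j) σ →
                      σ ≡ state fromTop L j ⊎ Σ (Fin n) λ j′ → σ ≡ state fromRight L j′ × toℕ j′ < toℕ j
    fromTop-reaches ε = inj₁ refl
    fromTop-reaches (moveDown _ e ◅ r) = ⊥-elim (no-row-below e)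
    fromTop-reaches (turnLeft _ e ◅ r) with fromRight-reaches r
    ... | j′ , refl , j′≤ = inj₂ (j′ , refl , <-≤-trans (s≤s j′≤) (≤-reflexive e))

    relbow-final : ∀ {j σ} → G L j ≡ relbow → Reaches (state fromRight L j) σ → σ ≡ state fromRight L j
    relbow-final q ε = refl
    relbow-final q (moveLeft p _ ◅ _) = ⊥-elim (passH≢relbow p q)
    relbow-final q (turnDown _ e ◅ _) = ⊥-elim (no-row-below e)

    passV-final : ∀ {j σ} → PassV (G L j) → Reaches (state fromTop L j) σ → σ ≡ state fromTop L j
    passV-final p ε = refl
    passV-final p (moveDown _ e ◅ _) = ⊥-elim (no-row-below e)
    passV-final p (turnLeft q _ ◅ _) = ⊥-elim (passV≢jelbow p q)

    fromTop-unique : ∀ {p y y′} → Trace G p fromTop L y → Trace G p fromTop L y′ → y ≡ y′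
    fromTop-unique t₁ t₂ with trace-linear t₁ t₂
    ... | inj₁ r with fromTop-reaches r
    ...   | inj₁ refl = refl
    ...   | inj₂ (_ , () , _)
    fromTop-unique t₁ t₂ | inj₂ r with fromTop-reaches r
    ...   | inj₁ refl = refl
    ...   | inj₂ (_ , () , _)

    own-pipe-not-fromTop : ∀ {y} → ¬ Trace G L fromTop L y
    own-pipe-not-fromTop t with trace⇒fromStart t
    ... | _ , _ , r with fromRight-reaches r
    ...   | _ , () , _

    fromRight-not-passV : ∀ {p y y′} → Trace G p fromRight L y → Trace G p fromTop L y′ → ¬ PassV (G L y′)
    fromRight-not-passV t₁ t₂ p with trace-linear t₁ t₂
    ... | inj₁ r with fromRight-reaches r
    ...   | _ , () , _
    fromRight-not-passV t₁ t₂ p | inj₂ r with passV-final p r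
    ... | ()

    fromTop-left-of-fromRight : ∀ {p z c} → Trace G p fromTop L z → Trace G p fromRight L c →
                                ¬ toℕ z < toℕ c
    fromTop-left-of-fromRight t₁ t₂ z<c with trace-linear t₁ t₂
    ... | inj₁ r with fromTop-reaches r
    ...   | inj₂ (_ , refl , c<z) = <-asym z<c c<z
    fromTop-left-of-fromRight t₁ t₂ z<c | inj₂ r with fromRight-reaches r
    ...   | _ , () , _

    relbow-leftmost : ∀ {p x c} → Trace G p fromRight L x → G L x ≡ relbow → Trace G p fromRight L c →
                      toℕ x ≤ toℕ c
    relbow-leftmost t₁ q t₂ with trace-linear t₁ t₂
    ... | inj₁ r with relbow-final q r
    ...   | refl = ≤-refl
    relbow-leftmost t₁ q t₂ | inj₂ r with fromRight-reaches r
    ...   | _ , refl , x≤c = x≤c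

    exit-column : ∀ {p j} → Trace G p fromTop L j → Σ (Fin n) λ x → toℕ x ≤ toℕ j × ExitsBottom G p x
    exit-column t with leave-row-fromTop t
    ... | x , x≤j , l = x , x≤j , L , L-last , l

  exit-unique : ∀ {p x x′} → ExitsBottom G p x → ExitsBottom G p x′ → x ≡ x′
  exit-unique (i , ei , l₁) (i′ , ei′ , l₂) with toℕ-injective {i = i} {j = i′} (suc-injective (trans ei (sym ei′)))
  ... | refl = leaves l₁ l₂
    where
    open LastRow i ei
    leaves : ∀ {p x x′} → LeavesDown p i x → LeavesDown p i x′ → x ≡ x′
    leaves (inj₁ (t₁ , q₁)) (inj₁ (t₂ , q₂)) with trace-linear t₁ t₂
    ... | inj₁ r = sym (cong column (relbow-final q₁ r))
    ... | inj₂ r = cong column (relbow-final q₂ r)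
    leaves (inj₁ (t₁ , _)) (inj₂ (t₂ , p₂)) = ⊥-elim (fromRight-not-passV t₁ t₂ p₂)
    leaves (inj₂ (t₁ , p₁)) (inj₁ (t₂ , _)) = ⊥-elim (fromRight-not-passV t₂ t₁ p₁)
    leaves (inj₂ (t₁ , p₁)) (inj₂ (t₂ , p₂)) with trace-linear t₁ t₂
    ... | inj₁ r = sym (cong column (passV-final p₁ r))
    ... | inj₂ r = cong column (passV-final p₂ r)

  module _ {r q : Fin h} (r<q : toℕ r < toℕ q) (j₀ : Fin n) (j₀-last : suc (toℕ j₀) ≡ n) where

    -- while the lower pipe q has not crossed r, pipe r enters each row reached by q to its left
    private
      RLeftOf : Side → Fin h → Fin n → Set
      RLeftOf fromRight i j = Σ (Fin n) λ j′ → toℕ j′ ≤ toℕ j × Trace G r fromTop i j′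
      RLeftOf fromTop   i j = Σ (Fin n) λ j′ → toℕ j′ < toℕ j × Trace G r fromTop i j′

      Crossing : Set
      Crossing = Σ (Fin h) λ i → Σ (Fin n) λ j → Crosses G q r i j

      r-left-of-q : ∀ {s i j} → Trace G q s i j → RLeftOf s i j ⊎ Crossing
      r-left-of-q (start j e) with enters-below j₀ j₀-last q r<q
      ... | j′ , t = inj₁ (j′ , ≤-last j′ e , t)
      r-left-of-q (goLeft {i} {j} {j′} t p e) with r-left-of-q t
      ... | inj₂ c = inj₂ c
      ... | inj₁ (j″ , j″≤j , tr) with toℕ j″ ≟ toℕ j
      ...   | no j″≢j = inj₁ (j″ , ≤-pred (≤-trans (≤∧≢⇒< j″≤j j″≢j) (≤-reflexive (sym e))) , tr)
      ...   | yes j″≡j with toℕ-injective j″≡j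
      ...     | refl = inj₂ (i , j , passH-top⇒cross p (trace-top tr) , inj₁ (t , tr))
      r-left-of-q (rTurn {i} {i′} {j} t rel e) with r-left-of-q t
      ... | inj₂ c = inj₂ c
      ... | inj₁ (j″ , j″≤j , tr) with toℕ j″ ≟ toℕ j
      ...   | yes j″≡j with toℕ-injective j″≡j
      ...     | refl = ⊥-elim (true≢false (trans (sym (trace-top tr)) (relbow-top rel)))
      r-left-of-q (rTurn t rel e) | inj₁ (j″ , j″≤j , tr) | no j″≢j with descend tr e
      ...     | x , x≤j″ , t′ = inj₁ (x , <-≤-trans (s≤s x≤j″) (≤∧≢⇒< j″≤j j″≢j) , t′)
      r-left-of-q (goDown t p e) with r-left-of-q t
      ... | inj₂ c = inj₂ c
      ... | inj₁ (j″ , j″<j , tr) with descend tr e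
      ...   | x , x≤j″ , t′ = inj₁ (x , <-≤-trans (s≤s x≤j″) j″<j , t′)
      r-left-of-q (jTurn t _ e) with r-left-of-q t
      ... | inj₂ c = inj₂ c
      ... | inj₁ (j″ , j″<j , tr) = inj₁ (j″ , ≤-pred (≤-trans j″<j (≤-reflexive (sym e))) , tr)

      r-left-of-exit : ∀ {i x} → LeavesDown q i x → RLeftOf fromRight i x ⊎ Crossing
      r-left-of-exit (inj₁ (tq , _)) = r-left-of-q tq
      r-left-of-exit (inj₂ (tq , _)) with r-left-of-q tq
      ... | inj₁ (j′ , j′<x , tr) = inj₁ (j′ , <⇒≤ j′<x , tr)
      ... | inj₂ c = inj₂ c

    pipes-cross : ∀ {xr xq} → ExitsBottom G r xr → ExitsBottom G q xq → toℕ xq < toℕ xr →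
                  Σ (Fin h) λ i → Σ (Fin n) λ j → Crosses G q r i j
    pipes-cross exr (L , L-last , lq) xq<xr with r-left-of-exit lq
    ... | inj₂ c = c
    ... | inj₁ (j′ , j′≤xq , tr) with LastRow.exit-column L L-last tr
    ...   | x , x≤j′ , ex with exit-unique ex exr
    ...     | refl = ⊥-elim (<-irrefl refl (<-≤-trans xq<xr (≤-trans x≤j′ j′≤xq)))

module _ {k n : ℕ} {D : Grid (suc k) n} where

  inject₁-suc : ∀ {i i′ : Fin k} → suc (toℕ i) ≡ toℕ i′ → suc (toℕ (inject₁ i)) ≡ toℕ (inject₁ i′)
  inject₁-suc {i} {i′} e = trans (cong suc (toℕ-inject₁ i)) (trans e (sym (toℕ-inject₁ i′)))

  lift-trace : ∀ {p s i j} → Trace (restrict D) p s i j → Trace D (inject₁ p) s (inject₁ i) j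
  lift-trace (start j e)    = start j e
  lift-trace (goLeft t p e) = goLeft (lift-trace t) p e
  lift-trace (rTurn t q e)  = rTurn (lift-trace t) q (inject₁-suc e)
  lift-trace (goDown t p e) = goDown (lift-trace t) p (inject₁-suc e)
  lift-trace (jTurn t q e)  = jTurn (lift-trace t) q e

  lift-crosses : ∀ {p q i j} → Crosses (restrict D) p q i j →
                 Crosses D (inject₁ p) (inject₁ q) (inject₁ i) j
  lift-crosses (c , inj₁ (t₁ , t₂)) = c , inj₁ (lift-trace t₁ , lift-trace t₂)
  lift-crosses (c , inj₂ (t₁ , t₂)) = c , inj₂ (lift-trace t₁ , lift-trace t₂)

  above-last : ∀ {i : Fin k} → suc (toℕ i) ≡ k → suc (toℕ (inject₁ i)) ≡ toℕ (fromℕ k)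
  above-last {i} e = trans (cong suc (toℕ-inject₁ i)) (trans e (sym (toℕ-fromℕ k)))

  exit⇒fromTop : ∀ {p x} → ExitsBottom (restrict D) p x → Trace D (inject₁ p) fromTop (fromℕ k) x
  exit⇒fromTop (i , ei , inj₁ (t , q)) = rTurn (lift-trace t) q (above-last ei)
  exit⇒fromTop (i , ei , inj₂ (t , p)) = goDown (lift-trace t) p (above-last ei)

lower₁′ : ∀ {k} (q : Fin (suc k)) → toℕ q < k → Σ (Fin k) λ q′ → inject₁ q′ ≡ q
lower₁′ q q<k = fromℕ< q<k , toℕ-injective (trans (toℕ-inject₁ _) (toℕ-fromℕ< q<k))

downward-induction : ∀ {m} (P : Fin m → Set) → (∀ i → suc (toℕ i) ≡ m → P i) →
                     (∀ i i′ → suc (toℕ i) ≡ toℕ i′ → P i′ → P i) → ∀ i → P i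
downward-induction {suc m} P P-last P-step =
  >-weakInduction P (P-last (fromℕ m) (cong suc (toℕ-fromℕ m)))
                    (λ i → P-step (inject₁ i) (suc i) (cong suc (toℕ-inject₁ i)))

chainFrom-last : ∀ {n m} (w : Fun n) (T : Fin m → Fun n) i x → suc (toℕ i) ≡ m →
                 chainFrom w T i x ≡ w x
chainFrom-last {m = suc zero}    w T zero    x e = refl
chainFrom-last {m = suc (suc m)} w T (suc i) x e = chainFrom-last w (T ∘ suc) i x (suc-injective e)

chainFrom-step : ∀ {n m} (w : Fun n) (T : Fin m → Fun n) i i′ → suc (toℕ i) ≡ toℕ i′ → ∀ x →
                 chainFrom w T i x ≡ chainFrom w T i′ (T i x)
chainFrom-step {m = suc (suc m)} w T zero    (suc zero) e x = refl
chainFrom-step {m = suc (suc m)} w T (suc i) (suc i′)   e x =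
  chainFrom-step w (T ∘ suc) i i′ (suc-injective e) x

decreasing-tail-determined : ∀ {n} (K : ℕ) (f g : Fun n) →
  (∀ x y → f x ≡ f y → x ≡ y) → (∀ x y → g x ≡ g y → x ≡ y) →
  (∀ y → ∃ λ x → f x ≡ y) → (∀ y → ∃ λ x → g x ≡ y) →
  (∀ x → toℕ x ≤ K → f x ≡ g x) →
  (∀ x y → K < toℕ x → toℕ x < toℕ y → toℕ (f y) < toℕ (f x)) →
  (∀ x y → K < toℕ x → toℕ x < toℕ y → toℕ (g y) < toℕ (g x)) →
  ∀ x → f x ≡ g x
decreasing-tail-determined {n} K f g f-inj g-inj f-surj g-surj prefix f-dec g-dec x =
  go (suc (toℕ x)) x ≤-refl
  where
  -- if F = G left of x, the value F x is taken by G at some position ≥ x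
  bound : ∀ (F G : Fun n) → (∀ x y → F x ≡ F y → x ≡ y) → (∀ y → ∃ λ x → G x ≡ y) →
          (∀ x → toℕ x ≤ K → F x ≡ G x) →
          (∀ x y → K < toℕ x → toℕ x < toℕ y → toℕ (G y) < toℕ (G x)) →
          ∀ x → K < toℕ x → (∀ y → toℕ y < toℕ x → F y ≡ G y) → toℕ (F x) ≤ toℕ (G x)
  bound F G F-inj G-surj F≗G G-dec x K<x left with G-surj (F x)
  ... | z , Gz≡Fx with toℕ z ≤? K
  ...   | yes z≤K = ⊥-elim (<-irrefl (cong toℕ (F-inj z x (trans (F≗G z z≤K) Gz≡Fx))) (≤-<-trans z≤K K<x))
  ...   | no _ with toℕ z <? toℕ x
  ...     | yes z<x = ⊥-elim (<-irrefl (cong toℕ (F-inj z x (trans (left z z<x) Gz≡Fx))) z<x)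
  ...     | no z≮x with toℕ z ≟ toℕ x
  ...       | yes z≡x = ≤-reflexive (cong toℕ (trans (sym Gz≡Fx) (cong G (toℕ-injective z≡x))))
  ...       | no z≢x =
    <⇒≤ (subst (λ v → toℕ v < toℕ (G x)) Gz≡Fx (G-dec x z K<x (≤∧≢⇒< (≮⇒≥ z≮x) (z≢x ∘ sym))))
  go : (fuel : ℕ) → ∀ x → toℕ x < fuel → f x ≡ g x
  go (suc fuel) x x<fuel with toℕ x ≤? K
  ... | yes x≤K = prefix x x≤K
  ... | no x≰K = toℕ-injective (≤-antisym
        (bound f g f-inj g-surj prefix g-dec x (≰⇒> x≰K) (λ y y<x → go fuel y (<-≤-trans y<x (s≤s⁻¹ x<fuel))))
        (bound g f g-inj f-surj (λ y y≤K → sym (prefix y y≤K)) f-dec x (≰⇒> x≰K)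
               (λ y y<x → sym (go fuel y (<-≤-trans y<x (s≤s⁻¹ x<fuel))))))

-- Inserting row k

module RowInsertion (n k′ : ℕ) (k<n : suc k′ < n)
    (D : Grid (suc k′) n) (D-bpd : IsBPD D)
    (u : Permutation′ n) (D-u : AssocPerm D u)
    (D⁻-bpd : IsBPD (restrict D)) (w : Permutation′ n) (D⁻-w : AssocPerm (restrict D) w)
    (m : ℕ) (c : Fin m → Fin n) (c-inc : StrictInc c)
    (c-complete : ∀ j → HorOrR (D (fromℕ k′) j) → ∃ λ i → c i ≡ j)
    (c-HorOrR : ∀ i → HorOrR (D (fromℕ k′) (c i)))
    (r : Fin m → Fin (suc k′)) (r-pipe : ∀ i → Trace D (r i) fromRight (fromℕ k′) (c i)) where

  -- Indices are 0-based: the paper's row k is `last` (k′ = k - 1), and the step from W (t + 1)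
  -- to W t transposes the positions a t = r t and b t = w⁻¹ (c t).
  open Pipes D D-bpd
  open IsBPD D-bpd using (leftEmpty; crossOnce)

  last : Fin (suc k′)
  last = fromℕ k′

  open LastRow last (cong suc (toℕ-fromℕ k′))

  ↑ : Fin (suc k′) → Fin n
  ↑ p = inject≤ p (<⇒≤ k<n)

  toℕ-↑ : ∀ p → toℕ (↑ p) ≡ toℕ p
  toℕ-↑ p = toℕ-inject≤ p (<⇒≤ k<n)

  ↑-injective : ∀ {p q} → ↑ p ≡ ↑ q → p ≡ q
  ↑-injective {p} {q} e = toℕ-injective (trans (sym (toℕ-↑ p)) (trans (cong toℕ e) (toℕ-↑ q)))

  ↑≤k′ : ∀ p → toℕ (↑ p) ≤ k′
  ↑≤k′ p = ≤-trans (≤-reflexive (toℕ-↑ p)) (≤-pred (toℕ<n p))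

  ↑-onto : ∀ (x : Fin n) → toℕ x ≤ k′ → Σ (Fin (suc k′)) λ p → ↑ p ≡ x
  ↑-onto x x≤k′ = fromℕ< (s≤s x≤k′) , toℕ-injective (trans (toℕ-↑ _) (toℕ-fromℕ< (s≤s x≤k′)))

  ↑last : toℕ (↑ last) ≡ k′
  ↑last = trans (toℕ-↑ last) (toℕ-fromℕ k′)

  w-injective : ∀ {x y} → w ⟨$⟩ʳ x ≡ w ⟨$⟩ʳ y → x ≡ y
  w-injective {x} {y} e = trans (sym (inverseˡ w)) (trans (cong (w ⟨$⟩ˡ_) e) (inverseˡ w))

  w⁻¹-injective : ∀ {x y} → w ⟨$⟩ˡ x ≡ w ⟨$⟩ˡ y → x ≡ y
  w⁻¹-injective {x} {y} e = trans (sym (inverseʳ w)) (trans (cong (w ⟨$⟩ʳ_) e) (inverseʳ w))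

  c-mono : ∀ {t t′} → toℕ t ≤ toℕ t′ → toℕ (c t) ≤ toℕ (c t′)
  c-mono {t} {t′} t≤t′ with toℕ t ≟ toℕ t′
  ... | yes t≡t′ rewrite toℕ-injective {i = t} {j = t′} t≡t′ = ≤-refl
  ... | no t≢t′ = <⇒≤ (c-inc t t′ (≤∧≢⇒< t≤t′ t≢t′))

  c-reflects-< : ∀ {t t′} → toℕ (c t) < toℕ (c t′) → toℕ t < toℕ t′
  c-reflects-< {t} {t′} lt with toℕ t <? toℕ t′
  ... | yes t<t′ = t<t′
  ... | no t≮t′ = ⊥-elim (<⇒≱ lt (c-mono (≮⇒≥ t≮t′)))

  c-injective : ∀ {t t′} → c t ≡ c t′ → t ≡ t′
  c-injective {t} {t′} e with <-cmp (toℕ t) (toℕ t′)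
  ... | tri< lt _ _ = ⊥-elim (<-irrefl (cong toℕ e) (c-inc t t′ lt))
  ... | tri≈ _ eq _ = toℕ-injective eq
  ... | tri> _ _ gt = ⊥-elim (<-irrefl (cong toℕ (sym e)) (c-inc t′ t gt))

  r-pipe-at : ∀ {t y} → c t ≡ y → Trace D (r t) fromRight last y
  r-pipe-at refl = r-pipe _

  r-pipe-of : ∀ {t p} → r t ≡ p → Trace D p fromRight last (c t)
  r-pipe-of refl = r-pipe _

  a b : Fin m → Fin n
  a t = ↑ (r t)
  b t = w ⟨$⟩ˡ c t

  τ : Fin m → Fun n
  τ t = PC.transpose (a t) (b t)

  W : Fin m → Fun n
  W = chainFrom (w ⟨$⟩ʳ_) τ

  fromTop-at-w : ∀ q → toℕ q < k′ → Trace D q fromTop last (w ⟨$⟩ʳ ↑ q)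
  fromTop-at-w q q<k′ with lower₁′ q q<k′
  ... | q′ , refl = exit⇒fromTop (proj₁ D⁻-w q′ (↑ q) (trans (toℕ-↑ q) (toℕ-inject₁ q′)))

  fromTop⇒above : ∀ {q y} → Trace D q fromTop last y → toℕ q < k′
  fromTop⇒above {q} t with toℕ q <? k′
  ... | yes q<k′ = q<k′
  ... | no q≮k′ with toℕ-injective {i = q} {j = last}
                       (trans (≤-antisym (≤-pred (toℕ<n q)) (≮⇒≥ q≮k′)) (sym (toℕ-fromℕ k′)))
  ...   | refl = ⊥-elim (own-pipe-not-fromTop t)

  fromTop⇒w : ∀ {q y} → Trace D q fromTop last y → w ⟨$⟩ʳ ↑ q ≡ y
  fromTop⇒w t = fromTop-unique (fromTop-at-w _ (fromTop⇒above t)) t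

  top-open⇒w : ∀ y → top (D last y) ≡ true →
               Σ (Fin (suc k′)) λ q → toℕ q < k′ × Trace D q fromTop last y × w ⟨$⟩ʳ ↑ q ≡ y
  top-open⇒w y top≡true with pipe-fromTop last y top≡true
  ... | q , t = q , fromTop⇒above t , t , fromTop⇒w t

  top-closed-beyond : ∀ x → k′ ≤ toℕ x → top (D last (w ⟨$⟩ʳ x)) ≢ true
  top-closed-beyond x k′≤x top≡true with top-open⇒w (w ⟨$⟩ʳ x) top≡true
  ... | q , q<k′ , _ , wq≡wx =
    <⇒≱ q<k′ (subst (k′ ≤_) (trans (cong toℕ (sym (w-injective wq≡wx))) (toℕ-↑ q)) k′≤x)

  HorOrR⇒beyond : ∀ x → HorOrR (D last (w ⟨$⟩ʳ x)) → k′ ≤ toℕ x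
  HorOrR⇒beyond x hr with k′ ≤? toℕ x
  ... | yes k′≤x = k′≤x
  ... | no k′≰x with ↑-onto x (<⇒≤ (≰⇒> k′≰x))
  ...   | p , refl = ⊥-elim (fromTop-not-HorOrR (fromTop-at-w p (subst (_< k′) (toℕ-↑ p) (≰⇒> k′≰x))) hr)

  CrossedBetween : Fin (suc k′) → Fin n → Fin n → Set
  CrossedBetween p y z = ∀ y′ → toℕ y < toℕ y′ → toℕ y′ < toℕ z →
                         D last y′ ≡ cross × Trace D p fromRight last y′

  data CameFrom (p : Fin (suc k′)) (y : Fin n) : Set where
    horizontal : ∀ z → toℕ y < toℕ z → Trace D p fromRight last z → D last z ≡ horiz →
                 CrossedBetween p y z → CameFrom p y
    jElbow     : ∀ z → toℕ y < toℕ z → Trace D p fromTop last z → D last z ≡ jelbow →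
                 CrossedBetween p y z → CameFrom p y
    boundary   : p ≡ last → (∀ y′ → toℕ y < toℕ y′ → D last y′ ≡ cross × Trace D p fromRight last y′) →
                 CameFrom p y

  came-from : ∀ {p y} → Trace D p fromRight last y → CameFrom p y
  came-from t = go t refl
    where
    nothing-between : ∀ {p y z} → suc (toℕ y) ≡ toℕ z → CrossedBetween p y z
    nothing-between e y′ y<y′ y′<z = ⊥-elim (<⇒≱ y′<z (≤-trans (≤-reflexive (sym e)) y<y′))
    crossed : ∀ {p y y₁ y′} → suc (toℕ y) ≡ toℕ y₁ → D last y₁ ≡ cross → Trace D p fromRight last y₁ →
              toℕ y < toℕ y′ → (toℕ y₁ < toℕ y′ → D last y′ ≡ cross × Trace D p fromRight last y′) →
              D last y′ ≡ cross × Trace D p fromRight last y′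
    crossed {y₁ = y₁} {y′} e cr t y<y′ further with toℕ y′ ≟ toℕ y₁
    ... | yes y′≡y₁ rewrite toℕ-injective {i = y′} {j = y₁} y′≡y₁ = cr , t
    ... | no y′≢y₁ = further (≤∧≢⇒< (≤-trans (≤-reflexive (sym e)) y<y′) (y′≢y₁ ∘ sym))
    go : ∀ {p i y} → Trace D p fromRight i y → i ≡ last → CameFrom p y
    go (start j e) refl = boundary refl (λ y′ j<y′ → ⊥-elim (<⇒≱ j<y′ (≤-last y′ e)))
    go (goLeft {j = y₁} t (inj₁ hz) e) refl = horizontal y₁ (≤-reflexive e) t hz (nothing-between e)
    go (jTurn {j = y₁} t je e) refl = jElbow y₁ (≤-reflexive e) t je (nothing-between e)
    go (goLeft {j = y₁} t (inj₂ cr) e) refl with go t refl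
    ... | horizontal z y₁<z tz hz btw =
      horizontal z (<-trans (≤-reflexive e) y₁<z) tz hz
                 (λ y′ y<y′ y′<z → crossed e cr t y<y′ (λ y₁<y′ → btw y′ y₁<y′ y′<z))
    ... | jElbow z y₁<z tz je btw =
      jElbow z (<-trans (≤-reflexive e) y₁<z) tz je
             (λ y′ y<y′ y′<z → crossed e cr t y<y′ (λ y₁<y′ → btw y′ y₁<y′ y′<z))
    ... | boundary p≡last all = boundary p≡last (λ y′ y<y′ → crossed e cr t y<y′ (all y′))

  fromRight-origin : ∀ {p y} → Trace D p fromRight last y →
                     p ≡ last ⊎ Σ (Fin n) λ z → toℕ y < toℕ z × Trace D p fromTop last z
  fromRight-origin t = go t refl
    where
    go : ∀ {p i y} → Trace D p fromRight i y → i ≡ last →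
         p ≡ last ⊎ Σ (Fin n) λ z → toℕ y < toℕ z × Trace D p fromTop last z
    go (start j e) refl = inj₁ refl
    go (goLeft t _ e) refl with go t refl
    ... | inj₁ p≡last = inj₁ p≡last
    ... | inj₂ (z , y₁<z , tz) = inj₂ (z , <-trans (≤-reflexive e) y₁<z , tz)
    go (jTurn {j = y₁} t _ e) refl = inj₂ (y₁ , ≤-reflexive e , t)

  record FirstHorOrR (p : Fin (suc k′)) (j : Fin n) : Set where
    field
      z       : Fin n
      trace   : Trace D p fromRight last z
      horOrR  : HorOrR (D last z)
      crosses : ∀ y → toℕ z < toℕ y → toℕ y ≤ toℕ j → D last y ≡ cross

  walk-through-crosses : ∀ {p j} → Trace D p fromRight last j → FirstHorOrR p j
  walk-through-crosses {j = j} = walk (suc (toℕ j)) ≤-refl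
    where
    walk : (fuel : ℕ) → ∀ {p j} → toℕ j < fuel → Trace D p fromRight last j → FirstHorOrR p j
    walk (suc fuel) {j = j} j<fuel t with right⇒passH⊎relbow (D last j) (trace-right t)
    ... | inj₂ rel       = record { z = j ; trace = t ; horOrR = inj₂ rel ; crosses = λ y j<y y≤j → ⊥-elim (<⇒≱ j<y y≤j) }
    ... | inj₁ (inj₁ hz) = record { z = j ; trace = t ; horOrR = inj₁ hz ; crosses = λ y j<y y≤j → ⊥-elim (<⇒≱ j<y y≤j) }
    ... | inj₁ (inj₂ cr)
      with ∃-predecessor j (λ j≡0 → true≢false (trans (sym (passH-left (inj₂ cr))) (leftEmpty last j j≡0)))
    ...   | j′ , e = record { z = FirstHorOrR.z next ; trace = FirstHorOrR.trace next
                        ; horOrR = FirstHorOrR.horOrR next ; crosses = crosses′ }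
      where
      next : FirstHorOrR _ j′
      next = walk fuel (≤-trans (≤-reflexive e) (s≤s⁻¹ j<fuel)) (goLeft t (inj₂ cr) e)
      crosses′ : ∀ y → toℕ (FirstHorOrR.z next) < toℕ y → toℕ y ≤ toℕ j → D last y ≡ cross
      crosses′ y z<y y≤j with toℕ y ≟ toℕ j
      ... | yes y≡j rewrite toℕ-injective {i = y} {j = j} y≡j = cr
      ... | no y≢j = FirstHorOrR.crosses next y z<y (≤-pred (≤-trans (≤∧≢⇒< y≤j y≢j) (≤-reflexive (sym e))))

  j₀ : Fin n
  j₀ = proj₁ (∃-last-column (<-trans z<s k<n))

  j₀-last : suc (toℕ j₀) ≡ n
  j₀-last = proj₂ (∃-last-column (<-trans z<s k<n))

  -- the pipe from the last row runs through crosses to its first tile of type HorOrR, at column zₖ = c tₘ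
  own-walk : FirstHorOrR last j₀
  own-walk = walk-through-crosses (start j₀ j₀-last)

  zₖ : Fin n
  zₖ = FirstHorOrR.z own-walk

  tₘ : Fin m
  tₘ = proj₁ (c-complete zₖ (FirstHorOrR.horOrR own-walk))

  c-tₘ : c tₘ ≡ zₖ
  c-tₘ = proj₂ (c-complete zₖ (FirstHorOrR.horOrR own-walk))

  crosses-right-of-zₖ : ∀ y → toℕ zₖ < toℕ y → D last y ≡ cross
  crosses-right-of-zₖ y zₖ<y = FirstHorOrR.crosses own-walk y zₖ<y (≤-last y j₀-last)

  tₘ-last : suc (toℕ tₘ) ≡ m
  tₘ-last with suc (toℕ tₘ) ≟ m
  ... | yes e = e
  ... | no ne with ∃-successor tₘ (≤∧≢⇒< (toℕ<n tₘ) ne)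
  ...   | t , e = ⊥-elim (HorOrR≢cross (c-HorOrR t)
                     (crosses-right-of-zₖ (c t) (subst (λ z → toℕ z < toℕ (c t)) c-tₘ (c-inc tₘ t (≤-reflexive e)))))

  r-tₘ : r tₘ ≡ last
  r-tₘ = trace-pipe-unique (r-pipe-at c-tₘ) (FirstHorOrR.trace own-walk)

  w-decreasing : ∀ {x x′} → k′ < toℕ x → toℕ x < toℕ x′ → toℕ (w ⟨$⟩ʳ x′) < toℕ (w ⟨$⟩ʳ x)
  w-decreasing {x} {x′} k′<x = proj₂ D⁻-w x x′ (<⇒≤ k′<x)

  k′≤b : ∀ t → k′ ≤ toℕ (b t)
  k′≤b t = HorOrR⇒beyond (b t) (subst (HorOrR ∘ D last) (sym (inverseʳ w)) (c-HorOrR t))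

  b-tₘ : toℕ (b tₘ) ≡ k′
  b-tₘ = ≤-antisym (≮⇒≥ not-beyond) (k′≤b tₘ)
    where
    -- otherwise w (↑ last) would lie right of zₖ, on a cross, yet the top of that tile is closed
    not-beyond : ¬ k′ < toℕ (b tₘ)
    not-beyond k′<b = top-closed-beyond (↑ last) (≤-reflexive (sym ↑last)) (cross-top (crosses-right-of-zₖ _ zₖ<w-last))
      where
      zₖ<w-last : toℕ zₖ < toℕ (w ⟨$⟩ʳ ↑ last)
      zₖ<w-last = subst (λ v → toℕ v < toℕ (w ⟨$⟩ʳ ↑ last)) (trans (inverseʳ w) c-tₘ)
        (proj₂ D⁻-w (↑ last) (b tₘ) (≤-reflexive (sym ↑last)) (subst (_< toℕ (b tₘ)) (sym ↑last) k′<b))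

  w-last : w ⟨$⟩ʳ ↑ last ≡ c tₘ
  w-last = trans (cong (w ⟨$⟩ʳ_) (toℕ-injective (trans ↑last (sym b-tₘ)))) (inverseʳ w)

  k′<b : ∀ t → suc (toℕ t) < m → k′ < toℕ (b t)
  k′<b t t<m-1 with toℕ (b t) ≟ k′
  ... | no b≢k′ = ≤∧≢⇒< (k′≤b t) (b≢k′ ∘ sym)
  ... | yes b≡k′ = ⊥-elim (<-irrefl (trans (cong (suc ∘ toℕ) t≡tₘ) tₘ-last) t<m-1)
    where
    t≡tₘ : t ≡ tₘ
    t≡tₘ = c-injective (trans (sym (inverseʳ w))
                              (trans (cong (w ⟨$⟩ʳ_) (toℕ-injective (trans b≡k′ (sym ↑last)))) w-last))

  W-step : ∀ i i′ → suc (toℕ i) ≡ toℕ i′ → ∀ x → W i x ≡ W i′ (τ i x)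
  W-step = chainFrom-step (w ⟨$⟩ʳ_) τ

  W-step-fixed : ∀ {i i′} → suc (toℕ i) ≡ toℕ i′ → ∀ {x} → τ i x ≡ x → W i x ≡ W i′ x
  W-step-fixed {i} {i′} e {x} fixed = trans (W-step i i′ e x) (cong (W i′) fixed)

  W-last : ∀ i x → suc (toℕ i) ≡ m → W i x ≡ w ⟨$⟩ʳ x
  W-last = chainFrom-last (w ⟨$⟩ʳ_) τ

  W-injective : ∀ i x y → W i x ≡ W i y → x ≡ y
  W-injective = downward-induction (λ i → ∀ x y → W i x ≡ W i y → x ≡ y)
    (λ i i-last x y e → w-injective (trans (sym (W-last i x i-last)) (trans e (W-last i y i-last))))
    (λ i i′ e ih x y Wx≡Wy → trans (sym (transpose-involutive (a i) (b i) x))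
       (trans (cong (τ i) (ih _ _ (trans (sym (W-step i i′ e x)) (trans Wx≡Wy (W-step i i′ e y)))))
              (transpose-involutive (a i) (b i) y)))

  W-surjective : ∀ i y → ∃ λ x → W i x ≡ y
  W-surjective = downward-induction (λ i → ∀ y → ∃ λ x → W i x ≡ y)
    (λ i i-last y → w ⟨$⟩ˡ y , trans (W-last i _ i-last) (inverseʳ w))
    (λ i i′ e ih y → τ i (proj₁ (ih y)) ,
       trans (W-step i i′ e _) (trans (cong (W i′) (transpose-involutive (a i) (b i) _)) (proj₂ (ih y))))

  not-last : ∀ {t t′ : Fin m} → suc (toℕ t) ≡ toℕ t′ → suc (toℕ t) < m
  not-last {t′ = t′} e = subst (_< m) (sym e) (toℕ<n t′)

  ≤⇒≡⊎next≤ : ∀ {i i′ t : Fin m} → suc (toℕ i) ≡ toℕ i′ → toℕ i ≤ toℕ t →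
              t ≡ i ⊎ toℕ i′ ≤ toℕ t
  ≤⇒≡⊎next≤ {i} {i′} {t} e i≤t with toℕ t ≟ toℕ i
  ... | yes t≡i = inj₁ (toℕ-injective t≡i)
  ... | no t≢i = inj₂ (≤-trans (≤-reflexive (sym e)) (≤∧≢⇒< i≤t (t≢i ∘ sym)))

  ↑≢b : ∀ p t → suc (toℕ t) < m → ↑ p ≢ b t
  ↑≢b p t t<m-1 ↑p≡bt = <⇒≱ (k′<b t t<m-1) (≤-trans (≤-reflexive (cong toℕ (sym ↑p≡bt))) (↑≤k′ p))

  ↑-fixed : ∀ p i → r i ≢ p → suc (toℕ i) < m → τ i (↑ p) ≡ ↑ p
  ↑-fixed p i ri≢p i<m-1 = transpose-other (a i) (b i) (↑ p) (ri≢p ∘ sym ∘ ↑-injective) (↑≢b p i i<m-1)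

  b-fixed : ∀ i t → t ≢ i → suc (toℕ t) < m → τ i (b t) ≡ b t
  b-fixed i t t≢i t<m-1 =
    transpose-other (a i) (b i) (b t) (↑≢b (r i) t t<m-1 ∘ sym) (t≢i ∘ c-injective ∘ w⁻¹-injective)

  ValueAtB : Fin m → Set
  ValueAtB i = ∀ t t′ → suc (toℕ t) ≡ toℕ t′ →
               (toℕ t < toℕ i → W i (b t) ≡ c t) × (toℕ i ≤ toℕ t → W i (b t) ≡ W t′ (a t))

  W-at-b : ∀ i → ValueAtB i
  W-at-b = downward-induction ValueAtB base step
    where
    base : ∀ i → suc (toℕ i) ≡ m → ValueAtB i
    base i i-last t t′ e = (λ _ → trans (W-last i (b t) i-last) (inverseʳ w)) ,
      (λ i≤t → ⊥-elim (<⇒≱ (not-last e) (≤-trans (≤-reflexive (sym i-last)) (s≤s i≤t))))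
    step : ∀ i i′ → suc (toℕ i) ≡ toℕ i′ → ValueAtB i′ → ValueAtB i
    step i i′ e ih t t′ e′ with toℕ t ≟ toℕ i
    ... | yes t≡i with toℕ-injective {i = t} {j = i} t≡i
    ...   | refl = (λ i<i → ⊥-elim (<-irrefl refl i<i)) ,
                   (λ _ → trans (W-step i i′ e (b i)) (trans (cong (W i′) (transpose-snd (a i) (b i)))
                                                             (cong (λ z → W z (a i)) (successor-unique e e′))))
    step i i′ e ih t t′ e′ | no t≢i =
      (λ t<i → trans W≡ (proj₁ (ih t t′ e′) (<-trans t<i (≤-reflexive e)))) ,
      (λ i≤t → trans W≡ (proj₂ (ih t t′ e′) (≤-trans (≤-reflexive (sym e)) (≤∧≢⇒< i≤t (t≢i ∘ sym)))))
      where
      W≡ : W i (b t) ≡ W i′ (b t)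
      W≡ = W-step-fixed e (b-fixed i t (t≢i ∘ cong toℕ) (not-last e′))

  data RowValue (i : Fin m) (p : Fin (suc k′)) : Set where
    unvisited : (∀ t → toℕ i ≤ toℕ t → r t ≢ p) → W i (↑ p) ≡ w ⟨$⟩ʳ ↑ p → RowValue i p
    visited   : ∀ t → toℕ i ≤ toℕ t → r t ≡ p → W i (↑ p) ≡ c t →
                (∀ t′ → toℕ i ≤ toℕ t′ → r t′ ≡ p → toℕ (c t) ≤ toℕ (c t′)) → RowValue i p

  W-at-row : ∀ i p → RowValue i p
  W-at-row = downward-induction (λ i → ∀ p → RowValue i p) base step
    where
    only-last : ∀ {i t} → suc (toℕ i) ≡ m → toℕ i ≤ toℕ t → t ≡ i
    only-last {i} {t} i-last i≤t = toℕ-injective (≤-antisym (≤-last t i-last) i≤t)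
    base : ∀ i → suc (toℕ i) ≡ m → ∀ p → RowValue i p
    base i i-last p with r i ≟ᶠ p
    ... | no ri≢p =
      unvisited (λ t i≤t rt≡p → ri≢p (trans (cong r (sym (only-last i-last i≤t))) rt≡p)) (W-last i _ i-last)
    ... | yes refl with toℕ-injective {i = i} {j = tₘ} (suc-injective (trans i-last (sym tₘ-last)))
    ...   | refl = visited tₘ ≤-refl refl
                     (trans (W-last tₘ _ i-last) (trans (cong (λ p → w ⟨$⟩ʳ ↑ p) r-tₘ) w-last))
                     (λ t tₘ≤t _ → ≤-reflexive (cong (toℕ ∘ c) (sym (only-last i-last tₘ≤t))))
    step : ∀ i i′ → suc (toℕ i) ≡ toℕ i′ → (∀ p → RowValue i′ p) → ∀ p → RowValue i p
    step i i′ e ih p with r i ≟ᶠ p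
    ... | yes refl = visited i ≤-refl refl
            (trans (W-step i i′ e (a i)) (trans (cong (W i′) (transpose-fst (a i) (b i)))
                                                (proj₁ (W-at-b i′ i i′ e) (≤-reflexive e))))
            (λ t i≤t _ → c-mono i≤t)
    ... | no ri≢p with ih p
    ...   | unvisited none W≡ = unvisited none′ (trans (W-step-fixed e (↑-fixed p i ri≢p (not-last e))) W≡)
      where
      none′ : ∀ t → toℕ i ≤ toℕ t → r t ≢ p
      none′ t i≤t with ≤⇒≡⊎next≤ e i≤t
      ... | inj₁ refl = ri≢p
      ... | inj₂ i′≤t = none t i′≤t
    ...   | visited t i′≤t rt≡p W≡ leftmost =
      visited t (≤-trans (n≤1+n _) (≤-trans (≤-reflexive e) i′≤t)) rt≡p
        (trans (W-step-fixed e (↑-fixed p i ri≢p (not-last e))) W≡) leftmost′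
      where
      leftmost′ : ∀ t′ → toℕ i ≤ toℕ t′ → r t′ ≡ p → toℕ (c t) ≤ toℕ (c t′)
      leftmost′ t′ i≤t′ with ≤⇒≡⊎next≤ e i≤t′
      ... | inj₁ refl = ⊥-elim ∘ ri≢p
      ... | inj₂ i′≤t′ = leftmost t′ i′≤t′

  W-at-a : ∀ t → W t (a t) ≡ c t
  W-at-a t with W-at-row t (r t)
  ... | unvisited none _ = ⊥-elim (none t ≤-refl refl)
  ... | visited t′ t≤t′ _ W≡ leftmost = trans W≡ (toℕ-injective (≤-antisym (leftmost t ≤-refl refl) (c-mono t≤t′)))

  W-elsewhere : ∀ i x → k′ < toℕ x → (∀ t → suc (toℕ t) < m → x ≢ b t) → W i x ≡ w ⟨$⟩ʳ x
  W-elsewhere = downward-induction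
    (λ i → ∀ x → k′ < toℕ x → (∀ t → suc (toℕ t) < m → x ≢ b t) → W i x ≡ w ⟨$⟩ʳ x)
    (λ i i-last x _ _ → W-last i x i-last)
    (λ i i′ e ih x k′<x x≢b → trans (W-step-fixed e (transpose-other (a i) (b i) x
       (λ x≡a → <⇒≱ k′<x (≤-trans (≤-reflexive (cong toℕ x≡a)) (↑≤k′ (r i))))
       (x≢b i (not-last e)))) (ih x k′<x x≢b))

  -- Between z and c t pipe r t runs through crosses only; at z it is horizontal or enters the row
  -- through a j-elbow.  The swaps after t have already brought z to position a t.
  record NextColumn (t t′ : Fin m) : Set where
    field
      z          : Fin n
      c<z        : toℕ (c t) < toℕ z
      W≡z        : W t′ (a t) ≡ z
      crossed    : CrossedBetween (r t) (c t) z
      horOrR⊎top : HorOrR (D last z) ⊎ top (D last z) ≡ true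

  next-column : ∀ t t′ → suc (toℕ t) ≡ toℕ t′ → NextColumn t t′
  next-column t t′ e with came-from (r-pipe t)
  ... | horizontal z c<z tz hz btw = record { z = z ; c<z = c<z ; W≡z = W≡z ; crossed = btw ; horOrR⊎top = inj₁ (inj₁ hz) }
    where
    t₂ : Fin m
    t₂ = proj₁ (c-complete z (inj₁ hz))
    c-t₂ : c t₂ ≡ z
    c-t₂ = proj₂ (c-complete z (inj₁ hz))
    t<t₂ : toℕ t < toℕ t₂
    t<t₂ = c-reflects-< (subst (λ z → toℕ (c t) < toℕ z) (sym c-t₂) c<z)
    t′≡t₂ : t′ ≡ t₂
    t′≡t₂ with toℕ t′ ≟ toℕ t₂
    ... | yes t′≡t₂ = toℕ-injective t′≡t₂
    ... | no t′≢t₂ = ⊥-elim (HorOrR≢cross (c-HorOrR t′) (proj₁ (btw (c t′) (c-inc t t′ (≤-reflexive e))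
            (subst (λ z → toℕ (c t′) < toℕ z) c-t₂
                   (c-inc t′ t₂ (≤∧≢⇒< (≤-trans (≤-reflexive (sym e)) t<t₂) t′≢t₂))))))
    c-t′ : c t′ ≡ z
    c-t′ = trans (cong c t′≡t₂) c-t₂
    W≡z : W t′ (a t) ≡ z
    W≡z = trans (cong (λ p → W t′ (↑ p)) (trace-pipe-unique tz (r-pipe-at c-t′))) (trans (W-at-a t′) c-t′)
  ... | jElbow z c<z tz je btw = record { z = z ; c<z = c<z ; W≡z = W≡z ; crossed = btw ; horOrR⊎top = inj₂ (jelbow-top je) }
    where
    W≡z : W t′ (a t) ≡ z
    W≡z with W-at-row t′ (r t)
    ... | unvisited _ W≡ = trans W≡ (fromTop⇒w tz)
    ... | visited t₃ t′≤t₃ rt₃≡ _ _ with <-cmp (toℕ (c t₃)) (toℕ z)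
    ...   | tri< c₃<z _ _ =
      ⊥-elim (HorOrR≢cross (c-HorOrR t₃)
                           (proj₁ (btw (c t₃) (c-inc t t₃ (≤-trans (≤-reflexive e) t′≤t₃)) c₃<z)))
    ...   | tri≈ _ c₃≡z _ =
      ⊥-elim (HorOrR≢jelbow (c-HorOrR t₃) (subst (λ z → D last z ≡ jelbow) (sym (toℕ-injective c₃≡z)) je))
    ...   | tri> _ _ z<c₃ = ⊥-elim (fromTop-left-of-fromRight tz (r-pipe-of rt₃≡) z<c₃)
  ... | boundary _ all = ⊥-elim (HorOrR≢cross (c-HorOrR t′) (proj₁ (all (c t′) (c-inc t t′ (≤-reflexive e)))))

  -- If q were below p, their exits from the first k rows would be out of order, forcing a crossing
  -- there, and two pipes cross at most once.
  crossing-from-above : ∀ {p q y} → Trace D p fromRight last y → Trace D q fromTop last y → D last y ≡ cross →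
                        toℕ q < toℕ p
  crossing-from-above {p} {q} {y} tp tq cr with <-cmp (toℕ q) (toℕ p)
  ... | tri< q<p _ _ = q<p
  ... | tri≈ _ q≡p _ rewrite toℕ-injective {i = q} {j = p} q≡p = ⊥-elim (fromRight-not-passV tp tq (inj₂ cr))
  ... | tri> _ _ p<q with fromRight-origin tp
  ...   | inj₁ refl = ⊥-elim (<-asym p<q (subst (toℕ q <_) (sym (toℕ-fromℕ k′)) (fromTop⇒above tq)))
  ...   | inj₂ (z , y<z , tz) with lower₁′ p (<-trans p<q (fromTop⇒above tq)) | lower₁′ q (fromTop⇒above tq)
  ...     | p′ , refl | q′ , refl
    with Pipes.pipes-cross (restrict D) D⁻-bpd p′<q′ j₀ j₀-last (exit p′) (exit q′) y<z′
    where
    p′<q′ : toℕ p′ < toℕ q′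
    p′<q′ = subst₂ _<_ (toℕ-inject₁ p′) (toℕ-inject₁ q′) p<q
    exit : ∀ s → ExitsBottom (restrict D) s (w ⟨$⟩ʳ ↑ (inject₁ s))
    exit s = proj₁ D⁻-w s (↑ (inject₁ s)) (trans (toℕ-↑ (inject₁ s)) (toℕ-inject₁ s))
    y<z′ : toℕ (w ⟨$⟩ʳ ↑ (inject₁ q′)) < toℕ (w ⟨$⟩ʳ ↑ (inject₁ p′))
    y<z′ = subst₂ (λ u v → toℕ u < toℕ v) (sym (fromTop⇒w tq)) (sym (fromTop⇒w tz)) y<z
  ...       | i , j , crosses with crossOnce (inject₁ q′) (inject₁ p′) (λ q≡p → <-irrefl (cong toℕ (sym q≡p)) p<q)
                                             (inject₁ i) j last y (lift-crosses crosses) (cr , inj₂ (tq , tp))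
  ...         | i≡last , _ =
    ⊥-elim (<-irrefl (trans (sym (toℕ-inject₁ i)) (trans (cong toℕ i≡last) (toℕ-fromℕ k′))) (toℕ<n i))

  module Step (t t′ : Fin m) (e : suc (toℕ t) ≡ toℕ t′) where
    open NextColumn (next-column t t′ e)

    W-at-b-is-z : W t (b t) ≡ z
    W-at-b-is-z = trans (proj₂ (W-at-b t t t′ e) ≤-refl) W≡z

    a<b : toℕ (a t) < toℕ (b t)
    a<b = ≤-<-trans (↑≤k′ (r t)) (k′<b t (not-last e))

    Wa<Wb : toℕ (W t (a t)) < toℕ (W t (b t))
    Wa<Wb = subst₂ (λ u v → toℕ u < toℕ v) (sym (W-at-a t)) (sym W-at-b-is-z) c<z

    -- a value strictly between c t and z sits on a cross of pipe r t, whose vertical pipe starts above r t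
    no-value-between : ∀ x → toℕ (a t) < toℕ x → toℕ x < toℕ (b t) →
                       toℕ (W t x) < toℕ (W t (a t)) ⊎ toℕ (W t (b t)) < toℕ (W t x)
    no-value-between x a<x x<b with <-cmp (toℕ (W t x)) (toℕ (c t))
    ... | tri< Wx<c _ _ = inj₁ (subst (λ v → toℕ (W t x) < toℕ v) (sym (W-at-a t)) Wx<c)
    ... | tri≈ _ Wx≡c _ =
      ⊥-elim (<-irrefl (cong toℕ (sym (W-injective t x (a t) (trans (toℕ-injective Wx≡c) (sym (W-at-a t)))))) a<x)
    ... | tri> _ _ c<Wx with <-cmp (toℕ (W t x)) (toℕ z)
    ...   | tri> _ _ z<Wx = inj₂ (subst (λ v → toℕ v < toℕ (W t x)) (sym W-at-b-is-z) z<Wx)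
    ...   | tri≈ _ Wx≡z _ =
      ⊥-elim (<-irrefl (cong toℕ (W-injective t x (b t) (trans (toℕ-injective Wx≡z) (sym W-at-b-is-z)))) x<b)
    ...   | tri< Wx<z _ _ with crossed (W t x) c<Wx Wx<z
    ...     | cr , tr with top-open⇒w (W t x) (cross-top cr)
    ...       | q , _ , tq , wq≡ =
      ⊥-elim (<-asym a<x (subst₂ _<_ (sym (trans (cong toℕ x≡↑q) (toℕ-↑ q))) (sym (toℕ-↑ (r t)))
                                     (crossing-from-above tr tq cr)))
      where
      x≡↑q : x ≡ ↑ q
      x≡↑q with W-at-row t q
      ... | unvisited _ W≡ = W-injective t x (↑ q) (sym (trans W≡ wq≡))
      ... | visited t₃ _ rt₃≡q _ _ = ⊥-elim (fromRight-not-passV (r-pipe-of rt₃≡q) tq (inj₂ cr))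

    W′≗W·t : ∀ x → W t′ x ≡ (W t ·t[ a t , b t ]) x
    W′≗W·t x = sym (trans (W-step t t′ e (τ t x)) (cong (W t′) (transpose-involutive (a t) (b t) x)))

    cover : CoverBy (suc k′) (W t) (W t′) (a t) (b t)
    cover = s≤s (↑≤k′ (r t)) , k′<b t (not-last e) , W′≗W·t ,
      trans (inv-cong W′≗W·t) (inv-transpose (W t) a<b Wa<Wb no-value-between)

    smaller-swapped : smallerSwapped (W t) (a t) (b t) ≡ toℕ (c t)
    smaller-swapped = trans (cong₂ (λ u v → toℕ u ⊓ toℕ v) (W-at-a t) W-at-b-is-z) (m≤n⇒m⊓n≡m (<⇒≤ c<z))

  module First (i₀ : Fin m) (i₀≡0 : toℕ i₀ ≡ 0) where

    i₀≤ : ∀ (t : Fin m) → toℕ i₀ ≤ toℕ t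
    i₀≤ t = subst (_≤ toℕ t) (sym i₀≡0) z≤n

    -- pipe p leaves the last row at the leftmost of its columns c t, or drops straight through it
    W₀-row : ∀ p → W i₀ (↑ p) ≡ u ⟨$⟩ʳ ↑ p
    W₀-row p with proj₁ D-u p (↑ p) (toℕ-↑ p)
    ... | L , L-last , _ with toℕ-injective {i = L} {j = last} (suc-injective (trans L-last (sym (cong suc (toℕ-fromℕ k′)))))
    W₀-row p | _ , _ , inj₁ (tp , rel) | refl with c-complete (u ⟨$⟩ʳ ↑ p) (inj₂ rel)
    ... | t , c-t with trace-pipe-unique (r-pipe-at c-t) tp | W-at-row i₀ p
    ...   | rt≡p | unvisited none _ = ⊥-elim (none t (i₀≤ t) rt≡p)
    ...   | rt≡p | visited t₃ _ rt₃≡p W≡ leftmost = trans W≡ (toℕ-injective (≤-antisym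
              (subst (λ v → toℕ (c t₃) ≤ toℕ v) c-t (leftmost t (i₀≤ t) rt≡p))
              (relbow-leftmost tp rel (r-pipe-of rt₃≡p))))
    W₀-row p | _ , _ , inj₂ (tp , pv) | refl with W-at-row i₀ p
    ... | unvisited _ W≡ = trans W≡ (fromTop⇒w tp)
    ... | visited t₃ _ rt₃≡p _ _ = ⊥-elim (fromRight-not-passV (r-pipe-of rt₃≡p) tp pv)

    W₀-prefix : ∀ x → toℕ x ≤ k′ → W i₀ x ≡ u ⟨$⟩ʳ x
    W₀-prefix x x≤k′ with ↑-onto x x≤k′
    ... | p , refl = W₀-row p

    record Moved (x : Fin n) : Set where
      field
        z          : Fin n
        w<z        : toℕ (w ⟨$⟩ʳ x) < toℕ z
        W≡z        : W i₀ x ≡ z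
        crossed    : ∀ y → toℕ (w ⟨$⟩ʳ x) < toℕ y → toℕ y < toℕ z → D last y ≡ cross
        horOrR⊎top : HorOrR (D last z) ⊎ top (D last z) ≡ true

    W₀-beyond : ∀ x → k′ < toℕ x →
                (HorOrR (D last (w ⟨$⟩ʳ x)) × Moved x) ⊎ (¬ HorOrR (D last (w ⟨$⟩ʳ x)) × W i₀ x ≡ w ⟨$⟩ʳ x)
    W₀-beyond x k′<x with HorOrR? (D last (w ⟨$⟩ʳ x))
    ... | no ¬hr = inj₂ (¬hr , W-elsewhere i₀ x k′<x (λ t _ x≡b → ¬hr (subst (HorOrR ∘ D last)
                                 (sym (trans (cong (w ⟨$⟩ʳ_) x≡b) (inverseʳ w))) (c-HorOrR t))))
    ... | yes hr with c-complete (w ⟨$⟩ʳ x) hr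
    ...   | t , c-t = inj₁ (hr , record
              { z = z
              ; w<z = subst (λ v → toℕ v < toℕ z) c-t c<z
              ; W≡z = trans (cong (W i₀) (sym b≡x)) (trans (proj₂ (W-at-b i₀ t t′ e) (i₀≤ t)) W≡z)
              ; crossed = λ y w<y y<z → proj₁ (crossed y (subst (λ v → toℕ v < toℕ y) (sym c-t) w<y) y<z)
              ; horOrR⊎top = horOrR⊎top })
      where
      b≡x : b t ≡ x
      b≡x = trans (cong (w ⟨$⟩ˡ_) c-t) (inverseˡ w)
      t<m-1 : suc (toℕ t) < m
      t<m-1 with suc (toℕ t) ≟ m
      ... | no ne = ≤∧≢⇒< (toℕ<n t) ne
      ... | yes t-last with toℕ-injective {i = t} {j = tₘ} (suc-injective (trans t-last (sym tₘ-last)))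
      ...   | refl = ⊥-elim (<-irrefl (sym (trans (cong toℕ (sym b≡x)) b-tₘ)) k′<x)
      t′ : Fin m
      t′ = proj₁ (∃-successor t t<m-1)
      e : suc (toℕ t) ≡ toℕ t′
      e = proj₂ (∃-successor t t<m-1)
      open NextColumn (next-column t t′ e)

    w≤W₀ : ∀ x → k′ < toℕ x → toℕ (w ⟨$⟩ʳ x) ≤ toℕ (W i₀ x)
    w≤W₀ x k′<x with W₀-beyond x k′<x
    ... | inj₁ (_ , mv) = <⇒≤ (subst (λ v → toℕ (w ⟨$⟩ʳ x) < toℕ v) (sym (Moved.W≡z mv)) (Moved.w<z mv))
    ... | inj₂ (_ , W≡) = ≤-reflexive (cong toℕ (sym W≡))

    W₀-decreasing : ∀ x x′ → k′ < toℕ x → toℕ x < toℕ x′ → toℕ (W i₀ x′) < toℕ (W i₀ x)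
    W₀-decreasing x x′ k′<x x<x′ with W₀-beyond x′ (<-trans k′<x x<x′)
    ... | inj₂ (_ , W≡) =
      subst (λ v → toℕ v < toℕ (W i₀ x)) (sym W≡) (<-≤-trans (w-decreasing k′<x x<x′) (w≤W₀ x k′<x))
    ... | inj₁ (_ , mv′) with <-cmp (toℕ (Moved.z mv′)) (toℕ (w ⟨$⟩ʳ x))
    ...   | tri< z′<w _ _ =
      subst (λ v → toℕ v < toℕ (W i₀ x)) (sym (Moved.W≡z mv′)) (<-≤-trans z′<w (w≤W₀ x k′<x))
    ...   | tri> _ _ w<z′ =
      ⊥-elim (top-closed-beyond x (<⇒≤ k′<x) (cross-top (Moved.crossed mv′ (w ⟨$⟩ʳ x) (w-decreasing k′<x x<x′) w<z′)))
    ...   | tri≈ _ z′≡w _ with Moved.horOrR⊎top mv′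
    ...     | inj₂ top≡true =
      ⊥-elim (top-closed-beyond x (<⇒≤ k′<x) (subst (λ v → top (D last v) ≡ true) (toℕ-injective z′≡w) top≡true))
    ...     | inj₁ hr with W₀-beyond x k′<x
    ...       | inj₂ (¬hr , _) = ⊥-elim (¬hr (subst (HorOrR ∘ D last) (toℕ-injective z′≡w) hr))
    ...       | inj₁ (_ , mv) = subst₂ (λ u v → toℕ u < toℕ v) (sym (Moved.W≡z mv′)) (sym (Moved.W≡z mv))
                                       (subst (λ v → toℕ v < toℕ (Moved.z mv)) (sym (toℕ-injective z′≡w)) (Moved.w<z mv))

    W₀≗u : ∀ x → W i₀ x ≡ u ⟨$⟩ʳ x
    W₀≗u = decreasing-tail-determined k′ (W i₀) (u ⟨$⟩ʳ_) (W-injective i₀)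
      (λ x y e → trans (sym (inverseˡ u)) (trans (cong (u ⟨$⟩ˡ_) e) (inverseˡ u)))
      (W-surjective i₀) (λ y → u ⟨$⟩ˡ y , inverseʳ u)
      W₀-prefix W₀-decreasing (proj₂ D-u)

lemma3p10 : (n k' : ℕ) → (k<n : suc k' < n) →
  (D : Grid (suc k') n) → IsBPD D →
  (u : Permutation′ n) → AssocPerm D u →
  IsBPD (restrict D) → (w : Permutation′ n) → AssocPerm (restrict D) w →
  (m : ℕ) (c : Fin m → Fin n) → StrictInc c →
  (∀ j → HorOrR (D (fromℕ k') j) → ∃ λ i → c i ≡ j) →
  (∀ i → HorOrR (D (fromℕ k') (c i))) →
  (r : Fin m → Fin (suc k')) → (∀ i → Trace D (r i) fromRight (fromℕ k') (c i)) →
  let W = chainFrom (w ⟨$⟩ʳ_)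
            (λ i x → transpose (inject≤ (r i) (<⇒≤ k<n)) (w ⟨$⟩ˡ c i) ⟨$⟩ʳ x)
  in (Σ (Fin m) λ i₀ → toℕ i₀ ≡ 0 × (∀ x → W i₀ x ≡ u ⟨$⟩ʳ x)) ×
     (∀ i x → suc (toℕ i) ≡ m → W i x ≡ w ⟨$⟩ʳ x) ×
     IncChain (suc k') W
lemma3p10 n k′ k<n D D-bpd u D-u D⁻-bpd w D⁻-w m c c-inc c-complete c-HorOrR r r-pipe =
  (i₀ , i₀≡0 , W₀≗u) , W-last , (a , b , Step.cover , increasing)
  where
  open RowInsertion n k′ k<n D D-bpd u D-u D⁻-bpd w D⁻-w m c c-inc c-complete c-HorOrR r r-pipe
  i₀ : Fin m
  i₀ = fromℕ< (≤-trans (s≤s z≤n) (toℕ<n tₘ))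
  i₀≡0 : toℕ i₀ ≡ 0
  i₀≡0 = toℕ-fromℕ< _
  open First i₀ i₀≡0
  increasing : ∀ i i′ i″ → suc (toℕ i) ≡ toℕ i′ → suc (toℕ i′) ≡ toℕ i″ →
               smallerSwapped (W i) (a i) (b i) < smallerSwapped (W i′) (a i′) (b i′)
  increasing i i′ i″ e e′ = subst₂ _<_ (sym (Step.smaller-swapped i i′ e)) (sym (Step.smaller-swapped i′ i″ e′))
                                       (c-inc i i′ (≤-reflexive e))
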